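{- Let $V$ be a closed test of the $\partial_0\lambda$-calculus with tests. Then $V\twoheadrightarrow\varepsilon$ if and only if $V\twoheadrightarrow_h\varepsilon$, and $V\twoheadrightarrow0$ if and only if $V\twoheadrightarrow_h0$.
   Context: Syntax of the $\partial_0\lambda$-calculus with tests. Terms $M ::= x \mid \lambda x.M \mid MP \mid \bar\tau(V)$, bags $P ::= [L_1,\dots,L_k]$, tests $V ::= \tau[L_1,\dots,L_k]$ ($k\ge 0$; finite multisets of terms, the tag $\tau$ distinguishes tests from bags), up to $\alpha$-equivalence. $\varepsilon:=\tau[\,]$; $V\mid W$ is multiset union of tests. Sums are finite formal sums with idempotent addition, $0$ the empty sum; constructors extend multilinearly to sums and give $0$ on $0$. $A\{0/x\}=0$ if $x$ is free in $A$, else $A$. Linear substitution: $x\langle N/x\rangle=N$; $y\langle N/x\rangle=0$ ($y\ne x$); $(\lambda y.M)\langle N/x\rangle=\lambda y.M\langle N/x\rangle$; $(MP)\langle N/x\rangle=M\langle N/x\rangle P+M(P\langle N/x\rangle)$; $\bar\tau(V)\langle N/x\rangle=\bar\tau(V\langle N/x\rangle)$; $[L_1,\dots,L_k]\langle N/x\rangle=\sum_i[L_1,\dots,L_i\langle N/x\rangle,\dots,L_k]$, likewise for tests; $A\langle[L_1,\dots,L_k]/x\rangle:=A\langle L_1/x\rangle\cdots\langle L_k/x\rangle$. Reduction: $(\lambda x.M)P\to M\langle P/x\rangle\{0/x\}$; $\bar\tau(V)P\to\bar\tau(V)$ if $P=[\,]$, else $\to0$; $\tau[\lambda x.M]\mid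 V\to\tau[M\{0/x\}]\mid V$; $\tau[\bar\tau(V)]\mid W\to V\mid W$; $\to$ is the closure under all syntactic positions and under sums ($A+\mathbb B\to\mathbb A+\mathbb B$ if $A\to\mathbb A$), $\twoheadrightarrow$ its reflexive-transitive closure. Head reduction. A term-redex is a term of the form $(\lambda x.M)P$ or $\bar\tau(V)P$; a test-redex is a test of the form $\tau[\lambda x.M]\mid V$ or $\tau[\bar\tau(V)]\mid W$. Head redexes: every test-redex is a head redex (of itself); a term-redex $H$ is a head redex in the term $\lambda y_1\dots y_m.HP_1\cdots P_p$ and in the test $\tau[HP_1\cdots P_p]\mid V$ ($m,p\ge0$). $A\to_h\mathbb B$ is a head-reduction step if $\mathbb B$ is obtained from $A$ by contracting a head redex of $A$; then also $A+\mathbb A\to_h\mathbb B+\mathbb A$. $\twoheadrightarrow_h$ is the reflexive-transitive closure of $\to_h$. -}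

module Defs where

open import Data.Nat using (ℕ; zero; suc; pred; _<ᵇ_; _≡ᵇ_)
open import Data.Bool using (Bool; true; false; if_then_else_; _∨_)
open import Data.List using (List; []; _∷_; _++_; map; concatMap)
open import Data.List.Membership.Propositional using (_∈_)
open import Data.Product using (∃-syntax; _×_)
open import Relation.Binary.PropositionalEquality using (_≡_)
open import Function.Bundles using (_⇔_)
open import Relation.Binary.Construct.Closure.ReflexiveTransitive using (Star)

-- Syntax (de Bruijn indices, so terms are taken up to α-equivalence).
-- Bags and tests are finite multisets of terms, represented by lists.

data Term : Set
data Test : Set

data Term where
  var  : ℕ → Term
  lam  : Term → Term
  app  : Term → List Term → Term
  tbar : Test → Term

data Test where
  τ : List Term → Test

Bag : Set
Bag = List Term

ε : Test
ε = τ []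

occT : ℕ → Term → Bool
occB : ℕ → Bag → Bool
occV : ℕ → Test → Bool
occT i (var j)   = j ≡ᵇ i
occT i (lam M)   = occT (suc i) M
occT i (app M P) = occT i M ∨ occB i P
occT i (tbar V)  = occV i V
occB i []        = false
occB i (L ∷ P)   = occT i L ∨ occB i P
occV i (τ P)     = occB i P

ClosedTest : Test → Set
ClosedTest V = ∀ i → occV i V ≡ false

-- Shifting (weakening) at cutoff c, and lowering (removal of the
-- unused index c).

shT : ℕ → Term → Term
shB : ℕ → Bag → Bag
shV : ℕ → Test → Test
shT c (var j)   = if j <ᵇ c then var j else var (suc j)
shT c (lam M)   = lam (shT (suc c) M)
shT c (app M P) = app (shT c M) (shB c P)
shT c (tbar V)  = tbar (shV c V)
shB c []        = []
shB c (L ∷ P)   = shT c L ∷ shB c P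
shV c (τ P)     = τ (shB c P)

loT : ℕ → Term → Term
loB : ℕ → Bag → Bag
loV : ℕ → Test → Test
loT c (var j)   = if j <ᵇ c then var j else var (pred j)
loT c (lam M)   = lam (loT (suc c) M)
loT c (app M P) = app (loT c M) (loB c P)
loT c (tbar V)  = tbar (loV c V)
loB c []        = []
loB c (L ∷ P)   = loT c L ∷ loB c P
loV c (τ P)     = τ (loB c P)

-- Sums: finite formal sums are lists (0 = [], + = _++_); idempotence
-- and commutativity are accounted for by comparing results as sets
-- (see _≈Σ_ below) and by reducing summands one at a time.

-- A{0/x} for x = index 0 (bound by the binder just removed):
-- 0 if x is free in A, otherwise A with x removed.
erase0 : Term → List Term
erase0 M = if occT 0 M then [] else (loT 0 M ∷ [])

-- Linear substitution A⟨N/i⟩ (N lives in the same context as A).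
linT : ℕ → Term → Term → List Term
linB : ℕ → Term → Bag → List Bag
linV : ℕ → Term → Test → List Test
linT i N (var j)   = if j ≡ᵇ i then N ∷ [] else []
linT i N (lam M)   = map lam (linT (suc i) (shT 0 N) M)
linT i N (app M P) = map (λ M′ → app M′ P) (linT i N M) ++ map (app M) (linB i N P)
linT i N (tbar V)  = map tbar (linV i N V)
linB i N []        = []
linB i N (L ∷ P)   = map (_∷ P) (linT i N L) ++ map (L ∷_) (linB i N P)
linV i N (τ P)     = map τ (linB i N P)

-- A⟨[L₁,…,Lₖ]/i⟩ = A⟨L₁/i⟩⋯⟨Lₖ/i⟩, extended linearly to sums.
linBag : ℕ → Bag → List Term → List Term
linBag i []      S = S
linBag i (L ∷ P) S = linBag i P (concatMap (linT i L) S)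

-- M⟨P/x⟩{0/x} for (λx.M)P, P in the outer context.
betaRed : Term → Bag → List Term
betaRed M P = concatMap erase0 (linBag 0 (shB 0 P) (M ∷ []))

data TermRedex : Term → List Term → Set where
  β      : ∀ M P → TermRedex (app (lam M) P) (betaRed M P)
  τ̄-nil  : ∀ V → TermRedex (app (tbar V) []) (tbar V ∷ [])
  τ̄-cons : ∀ V L P → TermRedex (app (tbar V) (L ∷ P)) []

data TestRedex : Test → List Test → Set where
  τλ : ∀ L M R → TestRedex (τ (L ++ lam M ∷ R)) (map (λ M′ → τ (L ++ M′ ∷ R)) (erase0 M))
  ττ̄ : ∀ L V R → TestRedex (τ (L ++ tbar (τ V) ∷ R)) (τ (L ++ V ++ R) ∷ [])

-- One-step reduction: closure of the rules under all syntactic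
-- positions (constructors extended multilinearly to sums).

data _→T_ : Term → List Term → Set
data _→B_ : Bag → List Bag → Set
data _→V_ : Test → List Test → Set

data _→T_ where
  redex : ∀ {M S} → TermRedex M S → M →T S
  lamC  : ∀ {M S} → M →T S → lam M →T map lam S
  appL  : ∀ {M S} P → M →T S → app M P →T map (λ M′ → app M′ P) S
  appR  : ∀ M {P S} → P →B S → app M P →T map (app M) S
  tbarC : ∀ {V S} → V →V S → tbar V →T map tbar S

data _→B_ where
  here  : ∀ {L S} P → L →T S → (L ∷ P) →B map (_∷ P) S
  there : ∀ L {P S} → P →B S → (L ∷ P) →B map (L ∷_) S

data _→V_ where
  redex : ∀ {V S} → TestRedex V S → V →V S
  τC    : ∀ {P S} → P →B S → τ P →V map τ S

data _→spine_ : Term → List Term → Set where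
  redex : ∀ {M S} → TermRedex M S → M →spine S
  appL  : ∀ {M S} P → M →spine S → app M P →spine map (λ M′ → app M′ P) S

data _→hT_ : Term → List Term → Set where
  spine : ∀ {M S} → M →spine S → M →hT S
  lamC  : ∀ {M S} → M →hT S → lam M →hT map lam S

data _→hV_ : Test → List Test → Set where
  redex : ∀ {V S} → TestRedex V S → V →hV S
  elem  : ∀ L {M S} R → M →spine S →
          τ (L ++ M ∷ R) →hV map (λ M′ → τ (L ++ M′ ∷ R)) S

data SumStep {A : Set} (R : A → List A → Set) : List A → List A → Set where
  sstep : ∀ L {a S} Rr → R a S → SumStep R (L ++ a ∷ Rr) (L ++ S ++ Rr)

_≈Σ_ : List Test → List Test → Set
S ≈Σ S′ = ∀ V → (V ∈ S) ⇔ (V ∈ S′)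

_↠_ : Test → List Test → Set
V ↠ 𝕊 = ∃[ S ] (Star (SumStep _→V_) (V ∷ []) S × S ≈Σ 𝕊)

_↠ₕ_ : Test → List Test → Set
V ↠ₕ 𝕊 = ∃[ S ] (Star (SumStep _→hV_) (V ∷ []) S × S ≈Σ 𝕊)

-- Both equivalences are decided by the relational model of the calculus, presented as a
-- non-idempotent intersection type system: contexts are multisets of points, a sum is
-- denoted by the union of its summands, and a test by the point ∗. Substitution being
-- linear, the semantics is invariant under reduction in both directions; in particular
-- whether V is denoted in the empty context is invariant, and it holds for ε but not for 0.
-- On the other hand, head reduction of a closed test terminates, since no step duplicates a
-- subterm and so the size decreases, and it can only stop at ε. Hence a closed V
-- head-reduces to a sum of copies of ε, which is ε or 0 according to whether V is denoted
-- in the empty context; by invariance the same is then true of any reduct ε or 0 of V.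

module Submission where

open import Defs
open import Data.Bool using (true; false; _∨_)
import Data.Bool.Properties as Bool
open import Data.Empty using (⊥-elim)
open import Data.List using (List; []; _∷_; [_]; _++_; map; concatMap)
import Data.List.Properties as List
open import Data.List.Membership.Propositional using (find; lose)
import Data.List.Membership.Propositional.Properties as ∈
open import Data.List.Relation.Unary.All as All using (All; []; _∷_)
import Data.List.Relation.Unary.All.Properties as Allₚ
open import Data.List.Relation.Unary.Any as Any using (Any; here; there)
import Data.List.Relation.Unary.Any.Properties as Anyₚ
open import Data.List.Relation.Binary.Permutation.Propositional
  using (_↭_; ↭-refl; ↭-sym; ↭-trans; ↭-reflexive)
import Data.List.Relation.Binary.Permutation.Propositional.Properties as ↭
open import Data.Nat using (ℕ; zero; suc; _+_; _≤_; _<_; s≤s; _<ᵇ_; _≡ᵇ_; _≟_)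
import Data.Nat.Properties as ℕ
open import Data.Product using (∃; ∃-syntax; _,_; proj₁; proj₂; _×_)
open import Data.Sum using (_⊎_; inj₁; inj₂)
open import Function.Base using (id; _∘_; case_of_)
open import Function.Bundles using (_⇔_; mk⇔; module Equivalence)
open import Function.Properties.Equivalence using () renaming (refl to ⇔-refl; trans to ⇔-trans)
open import Relation.Binary.Construct.Closure.ReflexiveTransitive as Star
  using (Star; _◅_; _◅◅_) renaming (ε to done)
open import Relation.Binary.PropositionalEquality hiding ([_])
open import Relation.Nullary using (¬_; yes; no)

-- Points and contexts

data D : Set where
  ∗   : D
  _⊸_ : List D → D → D

-- The reflexive object: ∗ behaves as [] ⊸ ∗, so that tests τ[…] and
-- τ̄(V) are denoted by ∗ and τ̄(V) absorbs exactly the empty bag.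
data Unfold : D → List D → D → Set where
  ∗-unfold : Unfold ∗ [] ∗
  ⊸-unfold : ∀ m b → Unfold (m ⊸ b) m b

Unfold-functional : ∀ {a m b m′ b′} → Unfold a m b → Unfold a m′ b′ → m ≡ m′ × b ≡ b′
Unfold-functional ∗-unfold       ∗-unfold       = refl , refl
Unfold-functional (⊸-unfold _ _) (⊸-unfold _ _) = refl , refl

-- A context assigns a multiset of points (a list up to ↭) to each index.
Ctx : Set
Ctx = ℕ → List D

infix  4 _≋_
infixl 6 _⊕_
infixr 5 _∷ᶜ_
infix  7 _↦_

_≋_ : Ctx → Ctx → Set
Γ ≋ Δ = ∀ i → Γ i ↭ Δ i

_⊕_ : Ctx → Ctx → Ctx
(Γ ⊕ Δ) i = Γ i ++ Δ i

∅ : Ctx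
∅ _ = []

_∷ᶜ_ : List D → Ctx → Ctx
(m ∷ᶜ Γ) zero    = m
(m ∷ᶜ Γ) (suc i) = Γ i

tailᶜ : Ctx → Ctx
tailᶜ Γ i = Γ (suc i)

_↦_ : ℕ → List D → Ctx
(zero  ↦ m) zero    = m
(zero  ↦ m) (suc j) = []
(suc i ↦ m) zero    = []
(suc i ↦ m) (suc j) = (i ↦ m) j

update : ℕ → List D → Ctx → Ctx
update zero    X Γ = X ∷ᶜ tailᶜ Γ
update (suc i) X Γ = Γ zero ∷ᶜ update i X (tailᶜ Γ)

insertᶜ : ℕ → Ctx → Ctx
insertᶜ zero    Γ zero    = []
insertᶜ zero    Γ (suc i) = Γ i
insertᶜ (suc c) Γ zero    = Γ zero
insertᶜ (suc c) Γ (suc i) = insertᶜ c (tailᶜ Γ) i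

deleteᶜ : ℕ → Ctx → Ctx
deleteᶜ zero    Γ i       = Γ (suc i)
deleteᶜ (suc c) Γ zero    = Γ zero
deleteᶜ (suc c) Γ (suc i) = deleteᶜ c (tailᶜ Γ) i

≋-refl : ∀ {Γ} → Γ ≋ Γ
≋-refl i = ↭-refl

≋-sym : ∀ {Γ Δ} → Γ ≋ Δ → Δ ≋ Γ
≋-sym p i = ↭-sym (p i)

≋-trans : ∀ {Γ Δ Θ} → Γ ≋ Δ → Δ ≋ Θ → Γ ≋ Θ
≋-trans p q i = ↭-trans (p i) (q i)

⊕-cong : ∀ {Γ Γ′ Δ Δ′} → Γ ≋ Γ′ → Δ ≋ Δ′ → Γ ⊕ Δ ≋ Γ′ ⊕ Δ′
⊕-cong p q i = ↭.++⁺ (p i) (q i)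

⊕-comm : ∀ Γ Δ → Γ ⊕ Δ ≋ Δ ⊕ Γ
⊕-comm Γ Δ i = ↭.++-comm (Γ i) (Δ i)

⊕-assoc : ∀ Γ Δ Θ → Γ ⊕ Δ ⊕ Θ ≋ Γ ⊕ (Δ ⊕ Θ)
⊕-assoc Γ Δ Θ i = ↭-reflexive (List.++-assoc (Γ i) (Δ i) (Θ i))

⊕-identityˡ : ∀ Γ → ∅ ⊕ Γ ≋ Γ
⊕-identityˡ Γ i = ↭-refl

⊕-identityʳ : ∀ Γ → Γ ⊕ ∅ ≋ Γ
⊕-identityʳ Γ i = ↭.++-identityʳ (Γ i)

⊕-swapʳ : ∀ Γ Δ Θ → Γ ⊕ Δ ⊕ Θ ≋ Γ ⊕ Θ ⊕ Δ
⊕-swapʳ Γ Δ Θ =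
  ≋-trans (⊕-assoc Γ Δ Θ) (≋-trans (⊕-cong (≋-refl {Γ}) (⊕-comm Δ Θ)) (≋-sym (⊕-assoc Γ Θ Δ)))

∷ᶜ-cong : ∀ {m m′ Γ Δ} → m ↭ m′ → Γ ≋ Δ → m ∷ᶜ Γ ≋ m′ ∷ᶜ Δ
∷ᶜ-cong p q zero    = p
∷ᶜ-cong p q (suc i) = q i

↦-[] : ∀ i → i ↦ [] ≋ ∅
↦-[] zero    zero    = ↭-refl
↦-[] zero    (suc j) = ↭-refl
↦-[] (suc i) zero    = ↭-refl
↦-[] (suc i) (suc j) = ↦-[] i j

↦-++ : ∀ i m n → i ↦ (m ++ n) ≋ i ↦ m ⊕ i ↦ n
↦-++ zero    m n zero    = ↭-refl
↦-++ zero    m n (suc j) = ↭-refl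
↦-++ (suc i) m n zero    = ↭-refl
↦-++ (suc i) m n (suc j) = ↦-++ i m n j

↦-here : ∀ i m → (i ↦ m) i ≡ m
↦-here zero    m = refl
↦-here (suc i) m = ↦-here i m

↦-elsewhere : ∀ i m j → j ≢ i → (i ↦ m) j ≡ []
↦-elsewhere zero    m zero    j≢i = ⊥-elim (j≢i refl)
↦-elsewhere zero    m (suc j) j≢i = refl
↦-elsewhere (suc i) m zero    j≢i = refl
↦-elsewhere (suc i) m (suc j) j≢i = ↦-elsewhere i m j (j≢i ∘ cong suc)

update-here : ∀ i X Γ → update i X Γ i ≡ X
update-here zero    X Γ = refl
update-here (suc i) X Γ = update-here i X (tailᶜ Γ)

update-elsewhere : ∀ i X Γ j → j ≢ i → update i X Γ j ≡ Γ j
update-elsewhere zero    X Γ zero    j≢i = ⊥-elim (j≢i refl)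
update-elsewhere zero    X Γ (suc j) j≢i = refl
update-elsewhere (suc i) X Γ zero    j≢i = refl
update-elsewhere (suc i) X Γ (suc j) j≢i = update-elsewhere i X (tailᶜ Γ) j (j≢i ∘ cong suc)

≋-at : ∀ i {Γ Δ} → Γ i ↭ Δ i → (∀ j → j ≢ i → Γ j ↭ Δ j) → Γ ≋ Δ
≋-at i at-i elsewhere j with j ≟ i
... | yes refl = at-i
... | no  j≢i  = elsewhere j j≢i

module _ {A : Set} where

  ++↭[]⁻ : ∀ {xs ys : List A} → xs ++ ys ↭ [] → xs ≡ [] × ys ≡ []
  ++↭[]⁻ {[]}    p = refl , ↭.↭-empty-inv p
  ++↭[]⁻ {_ ∷ _} p = ⊥-elim (↭.¬x∷xs↭[] p)

  ¬∷ʳ↭[] : ∀ {xs : List A} {a} → ¬ (xs ++ [ a ] ↭ [])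
  ¬∷ʳ↭[] {xs} p with () ← proj₂ (++↭[]⁻ {xs} p)

  ∷ʳ↭[_]⁻ : ∀ {xs : List A} {a} b → xs ++ [ a ] ↭ [ b ] → xs ≡ [] × a ≡ b
  ∷ʳ↭[_]⁻ {[]}         b p with refl ← ↭.↭-singleton-inv p = refl , refl
  ∷ʳ↭[_]⁻ {_ ∷ []}     b p with () ← ↭.↭-singleton-inv p
  ∷ʳ↭[_]⁻ {_ ∷ _ ∷ _}  b p with () ← ↭.↭-singleton-inv p

  ∷ʳ↭++⁻ : ∀ {a : A} (xs X Y : List A) → xs ++ [ a ] ↭ X ++ Y →
    (∃ λ X′ → X ↭ a ∷ X′ × xs ↭ X′ ++ Y) ⊎ (∃ λ Y′ → Y ↭ a ∷ Y′ × xs ↭ X ++ Y′)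
  ∷ʳ↭++⁻ {a} xs X Y p with ∈.∈-++⁻ X (↭.∈-resp-↭ p (∈.∈-++⁺ʳ xs (here refl)))
  ... | inj₁ a∈X with u , v , refl ← ∈.∈-∃++ a∈X = inj₁ (u ++ v , ↭.shift a u v ,
    ↭-trans (↭-sym (↭.++-identityʳ xs))
      (↭-trans (↭.drop-mid xs u (↭-trans p (↭-reflexive (List.++-assoc u (a ∷ v) Y))))
               (↭-reflexive (sym (List.++-assoc u v Y)))))
  ... | inj₂ a∈Y with u , v , refl ← ∈.∈-∃++ a∈Y = inj₂ (u ++ v , ↭.shift a u v ,
    ↭-trans (↭-sym (↭.++-identityʳ xs))
      (↭-trans (↭.drop-mid xs (X ++ u) (↭-trans p (↭-reflexive (sym (List.++-assoc X u (a ∷ v))))))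
               (↭-reflexive (List.++-assoc X u v))))

⊕↦-elsewhere : ∀ {Γ Θ i m} → Γ ⊕ i ↦ m ≋ Θ → ∀ j → j ≢ i → Γ j ↭ Θ j
⊕↦-elsewhere {Γ} {Θ} {i} {m} p j j≢i =
  ↭-trans (↭-sym (↭.++-identityʳ (Γ j))) (subst (λ z → Γ j ++ z ↭ Θ j) (↦-elsewhere i m j j≢i) (p j))

⊕↦-here : ∀ {Γ Θ i m} → Γ ⊕ i ↦ m ≋ Θ → Γ i ++ m ↭ Θ i
⊕↦-here {Γ} {Θ} {i} {m} p = subst (λ z → Γ i ++ z ↭ Θ i) (↦-here i m) (p i)

⊕↦-moveˡ : ∀ {Γ Γ₁ Γ₂ i a X} → Γ ⊕ i ↦ [ a ] ≋ Γ₁ ⊕ Γ₂ → Γ₁ i ↭ a ∷ X → Γ i ↭ X ++ Γ₂ i →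
  Γ₁ ≋ update i X Γ₁ ⊕ i ↦ [ a ] × Γ ≋ update i X Γ₁ ⊕ Γ₂
⊕↦-moveˡ {Γ} {Γ₁} {Γ₂} {i} {a} {X} p Γ₁i Γi =
  ≋-at i (subst₂ (λ u v → Γ₁ i ↭ u ++ v) (sym (update-here i X Γ₁)) (sym (↦-here i [ a ]))
            (↭-trans Γ₁i (↭.∷↭∷ʳ a X)))
         (λ j j≢i → subst₂ (λ u v → Γ₁ j ↭ u ++ v)
            (sym (update-elsewhere i X Γ₁ j j≢i)) (sym (↦-elsewhere i [ a ] j j≢i))
            (↭-sym (↭.++-identityʳ (Γ₁ j)))) ,
  ≋-at i (subst (λ u → Γ i ↭ u ++ Γ₂ i) (sym (update-here i X Γ₁)) Γi)
         (λ j j≢i → subst (λ u → Γ j ↭ u ++ Γ₂ j) (sym (update-elsewhere i X Γ₁ j j≢i))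
            (⊕↦-elsewhere p j j≢i))

⊕↦-split : ∀ {Γ Γ₁ Γ₂ i a} → Γ ⊕ i ↦ [ a ] ≋ Γ₁ ⊕ Γ₂ →
  (∃ λ Γ₁′ → Γ₁ ≋ Γ₁′ ⊕ i ↦ [ a ] × Γ ≋ Γ₁′ ⊕ Γ₂) ⊎
  (∃ λ Γ₂′ → Γ₂ ≋ Γ₂′ ⊕ i ↦ [ a ] × Γ ≋ Γ₁ ⊕ Γ₂′)
⊕↦-split {Γ} {Γ₁} {Γ₂} {i} p = case ∷ʳ↭++⁻ (Γ i) (Γ₁ i) (Γ₂ i) (⊕↦-here p) of λ where
  (inj₁ (X , Γ₁i , Γi)) → inj₁ (_ , ⊕↦-moveˡ p Γ₁i Γi)
  (inj₂ (Y , Γ₂i , Γi)) →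
    let Γ₂≋ , Γ≋ = ⊕↦-moveˡ (≋-trans p (⊕-comm Γ₁ Γ₂)) Γ₂i (↭-trans Γi (↭.++-comm (Γ₁ i) Y))
    in inj₂ (_ , Γ₂≋ , ≋-trans Γ≋ (⊕-comm _ Γ₁))

⊕↦≋↦⁻ : ∀ {Γ i a j b} → Γ ⊕ i ↦ [ a ] ≋ j ↦ [ b ] → i ≡ j × a ≡ b × Γ ≋ ∅
⊕↦≋↦⁻ {Γ} {i} {a} {j} {b} p with i ≟ j
... | no i≢j = ⊥-elim (¬∷ʳ↭[] (subst (Γ i ++ [ a ] ↭_) (↦-elsewhere j _ i i≢j) (⊕↦-here p)))
... | yes refl with Γi≡[] , refl ← ∷ʳ↭[ b ]⁻ (subst (Γ i ++ [ a ] ↭_) (↦-here i _) (⊕↦-here p)) =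
  refl , refl , ≋-at i (↭-reflexive Γi≡[])
    (λ k k≢i → subst (Γ k ↭_) (↦-elsewhere i _ k k≢i) (⊕↦-elsewhere p k k≢i))

-- The relational semantics

infix 4 _⊢_∶_ _⊢ᴮ_∶_ _⊢ⱽ_ _⊢ₛ_∶_ _⊢ⱽₛ_

data _⊢_∶_  : Ctx → Term → D → Set
data _⊢ᴮ_∶_ : Ctx → Bag → List D → Set

data _⊢_∶_ where
  ⊢var  : ∀ {Γ j a} → Γ ≋ j ↦ [ a ] → Γ ⊢ var j ∶ a
  ⊢lam  : ∀ {Γ Γ′ M a m b} → Unfold a m b → Γ′ ≋ m ∷ᶜ Γ → Γ′ ⊢ M ∶ b → Γ ⊢ lam M ∶ a
  ⊢app  : ∀ {Γ Γ₁ Γ₂ M P a m b} → Γ ≋ Γ₁ ⊕ Γ₂ →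
          Γ₁ ⊢ M ∶ a → Unfold a m b → Γ₂ ⊢ᴮ P ∶ m → Γ ⊢ app M P ∶ b
  ⊢tbar : ∀ {Γ Ls m} → All (_≡ ∗) m → Γ ⊢ᴮ Ls ∶ m → Γ ⊢ tbar (τ Ls) ∶ ∗

data _⊢ᴮ_∶_ where
  ⊢[] : ∀ {Γ} → Γ ≋ ∅ → Γ ⊢ᴮ [] ∶ []
  ⊢∷  : ∀ {Γ Γ₁ Γ₂ L P a m} → Γ ≋ Γ₁ ⊕ Γ₂ → Γ₁ ⊢ L ∶ a → Γ₂ ⊢ᴮ P ∶ m → Γ ⊢ᴮ L ∷ P ∶ a ∷ m

_⊢ⱽ_ : Ctx → Test → Set
Γ ⊢ⱽ τ Ls = ∃ λ m → All (_≡ ∗) m × Γ ⊢ᴮ Ls ∶ m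

_⊢ₛ_∶_ : Ctx → List Term → D → Set
Γ ⊢ₛ S ∶ a = Any (Γ ⊢_∶ a) S

_⊢ⱽₛ_ : Ctx → List Test → Set
Γ ⊢ⱽₛ S = Any (Γ ⊢ⱽ_) S

⊢ᴮ-resp-≋ : ∀ {Γ Δ P m} → Γ ≋ Δ → Γ ⊢ᴮ P ∶ m → Δ ⊢ᴮ P ∶ m
⊢ᴮ-resp-≋ e (⊢[] p)      = ⊢[] (≋-trans (≋-sym e) p)
⊢ᴮ-resp-≋ e (⊢∷ p ⊢L ⊢P) = ⊢∷ (≋-trans (≋-sym e) p) ⊢L ⊢P

⊢-resp-≋ : ∀ {Γ Δ M a} → Γ ≋ Δ → Γ ⊢ M ∶ a → Δ ⊢ M ∶ a
⊢-resp-≋ e (⊢var p)         = ⊢var (≋-trans (≋-sym e) p)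
⊢-resp-≋ e (⊢lam u p ⊢M)    = ⊢lam u (≋-trans p (∷ᶜ-cong ↭-refl e)) ⊢M
⊢-resp-≋ e (⊢app p ⊢M u ⊢P) = ⊢app (≋-trans (≋-sym e) p) ⊢M u ⊢P
⊢-resp-≋ e (⊢tbar s ⊢P)     = ⊢tbar s (⊢ᴮ-resp-≋ e ⊢P)

⊢tbar⁻ : ∀ {Γ V a} → Γ ⊢ tbar V ∶ a → a ≡ ∗ × Γ ⊢ⱽ V
⊢tbar⁻ (⊢tbar s ⊢P) = refl , (_ , s , ⊢P)

⊢tbar⁺ : ∀ {Γ} V → Γ ⊢ⱽ V → Γ ⊢ tbar V ∶ ∗
⊢tbar⁺ (τ Ls) (m , s , ⊢P) = ⊢tbar s ⊢P

⊢ε : ∅ ⊢ⱽ ε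
⊢ε = [] , [] , ⊢[] ≋-refl

∨-false⁻ : ∀ {a b} → a ∨ b ≡ false → a ≡ false × b ≡ false
∨-false⁻ {a} {b} e = Bool.∨-conicalˡ a b e , Bool.∨-conicalʳ a b e

∨-false⁺ : ∀ {a b} → a ≡ false → b ≡ false → a ∨ b ≡ false
∨-false⁺ refl refl = refl

∨-true⁻ : ∀ {a b} → a ∨ b ≡ true → a ≡ true ⊎ b ≡ true
∨-true⁻ {true}  e = inj₁ refl
∨-true⁻ {false} e = inj₂ e

occB≡false⇒All : ∀ i P → occB i P ≡ false → All (λ L → occT i L ≡ false) P
occB≡false⇒All i []      e = []
occB≡false⇒All i (L ∷ P) e with eL , eP ← ∨-false⁻ {occT i L} e = eL ∷ occB≡false⇒All i P eP

≡ᵇ-refl : ∀ i → (i ≡ᵇ i) ≡ true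
≡ᵇ-refl i = Equivalence.to Bool.T-≡ (ℕ.≡⇒≡ᵇ i i refl)

≡ᵇ-true⇒≡ : ∀ j i → (j ≡ᵇ i) ≡ true → j ≡ i
≡ᵇ-true⇒≡ j i e = ℕ.≡ᵇ⇒≡ j i (Equivalence.from Bool.T-≡ e)

≡ᵇ-false⇒≢ : ∀ j i → (j ≡ᵇ i) ≡ false → j ≢ i
≡ᵇ-false⇒≢ j .j e refl with () ← trans (sym e) (≡ᵇ-refl j)

occ≡false⇒↭[] : ∀ i {Θ M a} → occT i M ≡ false → Θ ⊢ M ∶ a → Θ i ↭ []
occᴮ≡false⇒↭[] : ∀ i {Θ P m} → occB i P ≡ false → Θ ⊢ᴮ P ∶ m → Θ i ↭ []
occ≡false⇒↭[] i {M = var j} e (⊢var p) =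
  subst (_ ↭_) (↦-elsewhere j _ i (≡ᵇ-false⇒≢ j i e ∘ sym)) (p i)
occ≡false⇒↭[] i {M = lam M} e (⊢lam u p ⊢M) = ↭-trans (↭-sym (p (suc i))) (occ≡false⇒↭[] (suc i) e ⊢M)
occ≡false⇒↭[] i {M = app M P} e (⊢app p ⊢M u ⊢P) with eM , eP ← ∨-false⁻ {occT i M} e =
  ↭-trans (p i) (↭.++⁺ (occ≡false⇒↭[] i eM ⊢M) (occᴮ≡false⇒↭[] i eP ⊢P))
occ≡false⇒↭[] i {M = tbar (τ Ls)} e (⊢tbar s ⊢P) = occᴮ≡false⇒↭[] i e ⊢P
occᴮ≡false⇒↭[] i e (⊢[] p) = p i
occᴮ≡false⇒↭[] i {P = L ∷ P} e (⊢∷ p ⊢L ⊢P) with eL , eP ← ∨-false⁻ {occT i L} e =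
  ↭-trans (p i) (↭.++⁺ (occ≡false⇒↭[] i eL ⊢L) (occᴮ≡false⇒↭[] i eP ⊢P))

occ≡true⇒≁[] : ∀ i {Θ M a} → occT i M ≡ true → Θ ⊢ M ∶ a → ¬ (Θ i ↭ [])
occᴮ≡true⇒≁[] : ∀ i {Θ P m} → occB i P ≡ true → Θ ⊢ᴮ P ∶ m → ¬ (Θ i ↭ [])
occ≡true⇒≁[] i {M = var j} e (⊢var p) z with refl ← ≡ᵇ-true⇒≡ j i e
  with () ← ↭.↭-empty-inv (↭-trans (↭-sym (subst (_ ↭_) (↦-here j _) (p j))) z)
occ≡true⇒≁[] i {M = lam M} e (⊢lam u p ⊢M) z = occ≡true⇒≁[] (suc i) e ⊢M (↭-trans (p (suc i)) z)
occ≡true⇒≁[] i {M = app M P} e (⊢app p ⊢M u ⊢P) z with z₁ , z₂ ← ++↭[]⁻ (↭-trans (↭-sym (p i)) z)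
  with ∨-true⁻ {occT i M} e
... | inj₁ eM = occ≡true⇒≁[] i eM ⊢M (↭-reflexive z₁)
... | inj₂ eP = occᴮ≡true⇒≁[] i eP ⊢P (↭-reflexive z₂)
occ≡true⇒≁[] i {M = tbar (τ Ls)} e (⊢tbar s ⊢P) z = occᴮ≡true⇒≁[] i e ⊢P z
occᴮ≡true⇒≁[] i {P = L ∷ P} e (⊢∷ p ⊢L ⊢P) z with z₁ , z₂ ← ++↭[]⁻ (↭-trans (↭-sym (p i)) z)
  with ∨-true⁻ {occT i L} e
... | inj₁ eL = occ≡true⇒≁[] i eL ⊢L (↭-reflexive z₁)
... | inj₂ eP = occᴮ≡true⇒≁[] i eP ⊢P (↭-reflexive z₂)

-- Weakening and strengthening

shℕ : ℕ → ℕ → ℕ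
shℕ zero    j       = suc j
shℕ (suc c) zero    = zero
shℕ (suc c) (suc j) = suc (shℕ c j)

shT-var : ∀ c j → shT c (var j) ≡ var (shℕ c j)
shT-var zero    zero    = refl
shT-var zero    (suc j) = refl
shT-var (suc c) zero    = refl
shT-var (suc c) (suc j) with j <ᵇ c | shT-var c j
... | true  | e = cong (λ { (var k) → var (suc k) ; t → t }) e
... | false | e = cong (λ { (var k) → var (suc k) ; t → t }) e

shℕ-≢ : ∀ c j → (shℕ c j ≡ᵇ c) ≡ false
shℕ-≢ zero    zero    = refl
shℕ-≢ zero    (suc j) = shℕ-≢ zero j
shℕ-≢ (suc c) zero    = refl
shℕ-≢ (suc c) (suc j) = shℕ-≢ c j

shℕ-≡ᵇ : ∀ c j i → (shℕ c j ≡ᵇ shℕ c i) ≡ (j ≡ᵇ i)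
shℕ-≡ᵇ zero    j       i       = refl
shℕ-≡ᵇ (suc c) zero    zero    = refl
shℕ-≡ᵇ (suc c) zero    (suc i) = refl
shℕ-≡ᵇ (suc c) (suc j) zero    = refl
shℕ-≡ᵇ (suc c) (suc j) (suc i) = shℕ-≡ᵇ c j i

insertᶜ-cong : ∀ c {Γ Δ} → Γ ≋ Δ → insertᶜ c Γ ≋ insertᶜ c Δ
insertᶜ-cong zero    e zero    = ↭-refl
insertᶜ-cong zero    e (suc i) = e i
insertᶜ-cong (suc c) e zero    = e zero
insertᶜ-cong (suc c) e (suc i) = insertᶜ-cong c (e ∘ suc) i

insertᶜ-⊕ : ∀ c Γ Δ → insertᶜ c (Γ ⊕ Δ) ≋ insertᶜ c Γ ⊕ insertᶜ c Δ
insertᶜ-⊕ zero    Γ Δ zero    = ↭-refl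
insertᶜ-⊕ zero    Γ Δ (suc i) = ↭-refl
insertᶜ-⊕ (suc c) Γ Δ zero    = ↭-refl
insertᶜ-⊕ (suc c) Γ Δ (suc i) = insertᶜ-⊕ c (tailᶜ Γ) (tailᶜ Δ) i

insertᶜ-∅ : ∀ c → insertᶜ c ∅ ≋ ∅
insertᶜ-∅ zero    zero    = ↭-refl
insertᶜ-∅ zero    (suc i) = ↭-refl
insertᶜ-∅ (suc c) zero    = ↭-refl
insertᶜ-∅ (suc c) (suc i) = insertᶜ-∅ c i

insertᶜ-↦ : ∀ c j X → insertᶜ c (j ↦ X) ≋ shℕ c j ↦ X
insertᶜ-↦ zero    j       X zero    = ↭-refl
insertᶜ-↦ zero    j       X (suc i) = ↭-refl
insertᶜ-↦ (suc c) zero    X zero    = ↭-refl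
insertᶜ-↦ (suc c) zero    X (suc i) = insertᶜ-∅ c i
insertᶜ-↦ (suc c) (suc j) X zero    = ↭-refl
insertᶜ-↦ (suc c) (suc j) X (suc i) = insertᶜ-↦ c j X i

insertᶜ-∷ᶜ : ∀ c m Γ → insertᶜ (suc c) (m ∷ᶜ Γ) ≋ m ∷ᶜ insertᶜ c Γ
insertᶜ-∷ᶜ c m Γ zero    = ↭-refl
insertᶜ-∷ᶜ c m Γ (suc i) = ↭-refl

deleteᶜ-cong : ∀ c {Γ Δ} → Γ ≋ Δ → deleteᶜ c Γ ≋ deleteᶜ c Δ
deleteᶜ-cong zero    e i       = e (suc i)
deleteᶜ-cong (suc c) e zero    = e zero
deleteᶜ-cong (suc c) e (suc i) = deleteᶜ-cong c (e ∘ suc) i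

deleteᶜ-⊕ : ∀ c Γ Δ → deleteᶜ c (Γ ⊕ Δ) ≋ deleteᶜ c Γ ⊕ deleteᶜ c Δ
deleteᶜ-⊕ zero    Γ Δ i       = ↭-refl
deleteᶜ-⊕ (suc c) Γ Δ zero    = ↭-refl
deleteᶜ-⊕ (suc c) Γ Δ (suc i) = deleteᶜ-⊕ c (tailᶜ Γ) (tailᶜ Δ) i

deleteᶜ-∅ : ∀ c → deleteᶜ c ∅ ≋ ∅
deleteᶜ-∅ zero    i       = ↭-refl
deleteᶜ-∅ (suc c) zero    = ↭-refl
deleteᶜ-∅ (suc c) (suc i) = deleteᶜ-∅ c i

deleteᶜ-↦ : ∀ c j X → deleteᶜ c (shℕ c j ↦ X) ≋ j ↦ X
deleteᶜ-↦ zero    j       X i       = ↭-refl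
deleteᶜ-↦ (suc c) zero    X zero    = ↭-refl
deleteᶜ-↦ (suc c) zero    X (suc i) = deleteᶜ-∅ c i
deleteᶜ-↦ (suc c) (suc j) X zero    = ↭-refl
deleteᶜ-↦ (suc c) (suc j) X (suc i) = deleteᶜ-↦ c j X i

deleteᶜ-∷ᶜ : ∀ c m Γ → deleteᶜ (suc c) (m ∷ᶜ Γ) ≋ m ∷ᶜ deleteᶜ c Γ
deleteᶜ-∷ᶜ c m Γ zero    = ↭-refl
deleteᶜ-∷ᶜ c m Γ (suc i) = ↭-refl

⊢-shT : ∀ c {Δ N a} → Δ ⊢ N ∶ a → insertᶜ c Δ ⊢ shT c N ∶ a
⊢ᴮ-shB : ∀ c {Δ P m} → Δ ⊢ᴮ P ∶ m → insertᶜ c Δ ⊢ᴮ shB c P ∶ m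
⊢-shT c {N = var j} (⊢var p) rewrite shT-var c j = ⊢var (≋-trans (insertᶜ-cong c p) (insertᶜ-↦ c j _))
⊢-shT c (⊢lam {m = m} u p ⊢M) =
  ⊢lam u (≋-trans (insertᶜ-cong (suc c) p) (insertᶜ-∷ᶜ c m _)) (⊢-shT (suc c) ⊢M)
⊢-shT c (⊢app p ⊢M u ⊢P) = ⊢app (≋-trans (insertᶜ-cong c p) (insertᶜ-⊕ c _ _)) (⊢-shT c ⊢M) u (⊢ᴮ-shB c ⊢P)
⊢-shT c (⊢tbar s ⊢P) = ⊢tbar s (⊢ᴮ-shB c ⊢P)
⊢ᴮ-shB c (⊢[] p) = ⊢[] (≋-trans (insertᶜ-cong c p) (insertᶜ-∅ c))
⊢ᴮ-shB c (⊢∷ p ⊢L ⊢P) = ⊢∷ (≋-trans (insertᶜ-cong c p) (insertᶜ-⊕ c _ _)) (⊢-shT c ⊢L) (⊢ᴮ-shB c ⊢P)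

⊢-shT⁻ : ∀ c {Θ N a} → Θ ⊢ shT c N ∶ a → deleteᶜ c Θ ⊢ N ∶ a
⊢ᴮ-shB⁻ : ∀ c {Θ P m} → Θ ⊢ᴮ shB c P ∶ m → deleteᶜ c Θ ⊢ᴮ P ∶ m
⊢-shT⁻ c {N = var j} ⊢N with shT c (var j) | shT-var c j
⊢-shT⁻ c {N = var j} (⊢var p) | _ | refl = ⊢var (≋-trans (deleteᶜ-cong c p) (deleteᶜ-↦ c j _))
⊢-shT⁻ c {N = lam M} (⊢lam {m = m} u p ⊢M) =
  ⊢lam u (≋-trans (deleteᶜ-cong (suc c) p) (deleteᶜ-∷ᶜ c m _)) (⊢-shT⁻ (suc c) ⊢M)
⊢-shT⁻ c {N = app M P} (⊢app p ⊢M u ⊢P) =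
  ⊢app (≋-trans (deleteᶜ-cong c p) (deleteᶜ-⊕ c _ _)) (⊢-shT⁻ c ⊢M) u (⊢ᴮ-shB⁻ c ⊢P)
⊢-shT⁻ c {N = tbar (τ Ls)} (⊢tbar s ⊢P) = ⊢tbar s (⊢ᴮ-shB⁻ c ⊢P)
⊢ᴮ-shB⁻ c {P = []} (⊢[] p) = ⊢[] (≋-trans (deleteᶜ-cong c p) (deleteᶜ-∅ c))
⊢ᴮ-shB⁻ c {P = L ∷ P} (⊢∷ p ⊢L ⊢P) =
  ⊢∷ (≋-trans (deleteᶜ-cong c p) (deleteᶜ-⊕ c _ _)) (⊢-shT⁻ c ⊢L) (⊢ᴮ-shB⁻ c ⊢P)

occ-shT-self : ∀ c N → occT c (shT c N) ≡ false
occ-shB-self : ∀ c P → occB c (shB c P) ≡ false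
occ-shT-self c (var j) rewrite shT-var c j = shℕ-≢ c j
occ-shT-self c (lam M) = occ-shT-self (suc c) M
occ-shT-self c (app M P) rewrite occ-shT-self c M | occ-shB-self c P = refl
occ-shT-self c (tbar (τ Ls)) = occ-shB-self c Ls
occ-shB-self c [] = refl
occ-shB-self c (L ∷ P) rewrite occ-shT-self c L | occ-shB-self c P = refl

occ-shT : ∀ c i N → occT (shℕ c i) (shT c N) ≡ occT i N
occ-shB : ∀ c i P → occB (shℕ c i) (shB c P) ≡ occB i P
occ-shT c i (var j) rewrite shT-var c j = shℕ-≡ᵇ c j i
occ-shT c i (lam M) = occ-shT (suc c) (suc i) M
occ-shT c i (app M P) rewrite occ-shT c i M | occ-shB c i P = refl
occ-shT c i (tbar (τ Ls)) = occ-shB c i Ls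
occ-shB c i [] = refl
occ-shB c i (L ∷ P) rewrite occ-shT c i L | occ-shB c i P = refl

<ᵇ-false-≢⇒suc : ∀ c j → (j <ᵇ c) ≡ false → (j ≡ᵇ c) ≡ false →
  ∃ λ k → j ≡ suc k × (k <ᵇ c) ≡ false
<ᵇ-false-≢⇒suc zero    zero          _  ()
<ᵇ-false-≢⇒suc zero    (suc k)       _  _ = k , refl , refl
<ᵇ-false-≢⇒suc (suc c) zero          () _
<ᵇ-false-≢⇒suc (suc c) (suc j)       e₁ e₂ with k , refl , e ← <ᵇ-false-≢⇒suc c j e₁ e₂ =
  suc k , refl , e

shT∘loT : ∀ c M → occT c M ≡ false → shT c (loT c M) ≡ M
shB∘loB : ∀ c P → occB c P ≡ false → shB c (loB c P) ≡ P
shT∘loT c (var j) e with j <ᵇ c in j<c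
... | true rewrite j<c = refl
... | false with k , refl , k≮c ← <ᵇ-false-≢⇒suc c j j<c e rewrite k≮c = refl
shT∘loT c (lam M) e = cong lam (shT∘loT (suc c) M e)
shT∘loT c (app M P) e with eM , eP ← ∨-false⁻ {occT c M} e = cong₂ app (shT∘loT c M eM) (shB∘loB c P eP)
shT∘loT c (tbar (τ Ls)) e = cong (tbar ∘ τ) (shB∘loB c Ls e)
shB∘loB c [] e = refl
shB∘loB c (L ∷ P) e with eL , eP ← ∨-false⁻ {occT c L} e = cong₂ _∷_ (shT∘loT c L eL) (shB∘loB c P eP)

-- Linear substitution

Any-mapWith : ∀ {A B : Set} {P : A → Set} {Q : B → Set} (f : A → B) {xs} →
  (∀ {x} → P x → Q (f x)) → Any P xs → Any Q (map f xs)
Any-mapWith f g = Anyₚ.map⁺ ∘ Any.map g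

∷ᶜ-⊕-insertᶜ : ∀ m Γ Δ → (m ∷ᶜ Γ) ⊕ insertᶜ 0 Δ ≋ m ∷ᶜ (Γ ⊕ Δ)
∷ᶜ-⊕-insertᶜ m Γ Δ zero    = ↭.++-identityʳ m
∷ᶜ-⊕-insertᶜ m Γ Δ (suc i) = ↭-refl

∷ᶜ-⊕-↦ : ∀ m Γ i a → m ∷ᶜ (Γ ⊕ i ↦ [ a ]) ≋ (m ∷ᶜ Γ) ⊕ suc i ↦ [ a ]
∷ᶜ-⊕-↦ m Γ i a zero    = ↭-sym (↭.++-identityʳ m)
∷ᶜ-⊕-↦ m Γ i a (suc k) = ↭-refl

⊢-linT : ∀ i {Θ Γ Δ M N a b} → Θ ⊢ M ∶ b → Θ ≋ Γ ⊕ i ↦ [ a ] → Δ ⊢ N ∶ a → Γ ⊕ Δ ⊢ₛ linT i N M ∶ b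
⊢ᴮ-linB : ∀ i {Θ Γ Δ P N a m} → Θ ⊢ᴮ P ∶ m → Θ ≋ Γ ⊕ i ↦ [ a ] → Δ ⊢ N ∶ a →
  Any (Γ ⊕ Δ ⊢ᴮ_∶ m) (linB i N P)
⊢-linT i {Γ = Γ} {Δ} {M = var j} {a = a} {b} (⊢var p) e ⊢N
  with refl , refl , Γ≋∅ ← ⊕↦≋↦⁻ {Γ} {i} {a} {j} {b} (≋-trans (≋-sym e) p) rewrite ≡ᵇ-refl i =
  here (⊢-resp-≋ (≋-trans (≋-sym (⊕-identityˡ Δ)) (⊕-cong (≋-sym Γ≋∅) ≋-refl)) ⊢N)
⊢-linT i {Γ = Γ} {Δ} {M = lam M} {a = a} (⊢lam {m = m} u p ⊢M) e ⊢N =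
  Any-mapWith lam (⊢lam u (∷ᶜ-⊕-insertᶜ m Γ Δ))
    (⊢-linT (suc i) ⊢M (≋-trans p (≋-trans (∷ᶜ-cong ↭-refl e) (∷ᶜ-⊕-↦ m Γ i a))) (⊢-shT 0 ⊢N))
⊢-linT i {Γ = Γ} {Δ} {M = app M P} (⊢app {Γ₁ = Θ₁} {Θ₂} p ⊢M u ⊢P) e ⊢N
  with ⊕↦-split {Γ} {Θ₁} {Θ₂} {i} (≋-trans (≋-sym e) p)
... | inj₁ (Γ₁ , Θ₁≋ , Γ≋) = Anyₚ.++⁺ˡ (Any-mapWith (λ M′ → app M′ P)
  (λ ⊢M′ → ⊢app (≋-trans (⊕-cong Γ≋ ≋-refl) (⊕-swapʳ Γ₁ Θ₂ Δ)) ⊢M′ u ⊢P) (⊢-linT i ⊢M Θ₁≋ ⊢N))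
... | inj₂ (Γ₂ , Θ₂≋ , Γ≋) = Anyₚ.++⁺ʳ _ (Any-mapWith (app M)
  (λ ⊢P′ → ⊢app (≋-trans (⊕-cong Γ≋ ≋-refl) (⊕-assoc Θ₁ Γ₂ Δ)) ⊢M u ⊢P′) (⊢ᴮ-linB i ⊢P Θ₂≋ ⊢N))
⊢-linT i {M = tbar (τ Ls)} (⊢tbar s ⊢P) e ⊢N =
  Any-mapWith tbar id (Any-mapWith τ (⊢tbar s) (⊢ᴮ-linB i ⊢P e ⊢N))
⊢ᴮ-linB i {Γ = Γ} {a = a} (⊢[] p) e ⊢N = ⊥-elim (¬∷ʳ↭[] (⊕↦-here {Γ} {i = i} {[ a ]} (≋-trans (≋-sym e) p)))
⊢ᴮ-linB i {Γ = Γ} {Δ} {P = L ∷ P} (⊢∷ {Γ₁ = Θ₁} {Θ₂} p ⊢L ⊢P) e ⊢N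
  with ⊕↦-split {Γ} {Θ₁} {Θ₂} {i} (≋-trans (≋-sym e) p)
... | inj₁ (Γ₁ , Θ₁≋ , Γ≋) = Anyₚ.++⁺ˡ (Any-mapWith (_∷ P)
  (λ ⊢L′ → ⊢∷ (≋-trans (⊕-cong Γ≋ ≋-refl) (⊕-swapʳ Γ₁ Θ₂ Δ)) ⊢L′ ⊢P) (⊢-linT i ⊢L Θ₁≋ ⊢N))
... | inj₂ (Γ₂ , Θ₂≋ , Γ≋) = Anyₚ.++⁺ʳ _ (Any-mapWith (L ∷_)
  (λ ⊢P′ → ⊢∷ (≋-trans (⊕-cong Γ≋ ≋-refl) (⊕-assoc Θ₁ Γ₂ Δ)) ⊢L ⊢P′) (⊢ᴮ-linB i ⊢P Θ₂≋ ⊢N))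

⊢-linT⁻ : ∀ i {Θ M N b} → Θ ⊢ₛ linT i N M ∶ b →
  ∃[ Γ ] ∃[ Δ ] ∃[ a ] Θ ≋ Γ ⊕ Δ × Γ ⊕ i ↦ [ a ] ⊢ M ∶ b × Δ ⊢ N ∶ a
⊢ᴮ-linB⁻ : ∀ i {Θ P N m} → Any (Θ ⊢ᴮ_∶ m) (linB i N P) →
  ∃[ Γ ] ∃[ Δ ] ∃[ a ] Θ ≋ Γ ⊕ Δ × Γ ⊕ i ↦ [ a ] ⊢ᴮ P ∶ m × Δ ⊢ N ∶ a
⊢-linT⁻ i {Θ} {var j} {b = b} q with j ≡ᵇ i in j≡ᵇi
⊢-linT⁻ i {Θ} {var j} {b = b} (here ⊢N) | true with refl ← ≡ᵇ-true⇒≡ j i j≡ᵇi =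
  ∅ , Θ , b , ≋-refl , ⊢var ≋-refl , ⊢N
⊢-linT⁻ i {Θ} {lam M} {N} q
  with _ , M′∈ , ⊢lam {Γ′ = Γ′} u p ⊢M′ ← find (Anyₚ.map⁻ q)
  with Γ , Δ , a , Γ′≋ , ⊢M , ⊢N ← ⊢-linT⁻ (suc i) {Γ′} {M} {shT 0 N} (lose M′∈ ⊢M′) =
  tailᶜ Γ , tailᶜ Δ , a , (λ k → ↭-trans (↭-sym (p (suc k))) (Γ′≋ (suc k))) ,
  ⊢lam u (λ { zero    → ↭-trans (↭-sym (↭.++⁺ˡ (Γ 0) Δ₀≋[])) (↭-trans (↭-sym (Γ′≋ 0)) (p 0))
            ; (suc k) → ↭-refl }) ⊢M ,
  ⊢-shT⁻ 0 ⊢N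
  where
  Δ₀≋[] : Δ 0 ↭ []
  Δ₀≋[] = occ≡false⇒↭[] 0 (occ-shT-self 0 N) ⊢N
⊢-linT⁻ i {Θ} {app M P} {N} q with Anyₚ.++⁻ (map (λ M′ → app M′ P) (linT i N M)) q
... | inj₁ q₁
  with _ , M′∈ , ⊢app {Γ₂ = Θ₂} p ⊢M′ u ⊢P ← find (Anyₚ.map⁻ q₁)
  with Γ , Δ , a , e , ⊢M , ⊢N ← ⊢-linT⁻ i (lose M′∈ ⊢M′) =
  Γ ⊕ Θ₂ , Δ , a , ≋-trans p (≋-trans (⊕-cong e ≋-refl) (⊕-swapʳ Γ Δ Θ₂)) ,
  ⊢app (⊕-swapʳ Γ Θ₂ (i ↦ [ a ])) ⊢M u ⊢P , ⊢N
... | inj₂ q₂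
  with _ , P′∈ , ⊢app {Γ₁ = Θ₁} p ⊢M u ⊢P′ ← find (Anyₚ.map⁻ q₂)
  with Γ , Δ , a , e , ⊢P , ⊢N ← ⊢ᴮ-linB⁻ i (lose P′∈ ⊢P′) =
  Θ₁ ⊕ Γ , Δ , a , ≋-trans p (≋-trans (⊕-cong ≋-refl e) (≋-sym (⊕-assoc Θ₁ Γ Δ))) ,
  ⊢app (⊕-assoc Θ₁ Γ (i ↦ [ a ])) ⊢M u ⊢P , ⊢N
⊢-linT⁻ i {Θ} {tbar (τ Ls)} q
  with _ , P′∈ , ⊢tbar s ⊢P′ ← find (Anyₚ.map⁻ (Anyₚ.map⁻ q))
  with Γ , Δ , a , e , ⊢P , ⊢N ← ⊢ᴮ-linB⁻ i (lose P′∈ ⊢P′) =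
  Γ , Δ , a , e , ⊢tbar s ⊢P , ⊢N
⊢ᴮ-linB⁻ i {Θ} {L ∷ P} {N} q with Anyₚ.++⁻ (map (_∷ P) (linT i N L)) q
... | inj₁ q₁
  with _ , L′∈ , ⊢∷ {Γ₂ = Θ₂} p ⊢L′ ⊢P ← find (Anyₚ.map⁻ q₁)
  with Γ , Δ , a , e , ⊢L , ⊢N ← ⊢-linT⁻ i (lose L′∈ ⊢L′) =
  Γ ⊕ Θ₂ , Δ , a , ≋-trans p (≋-trans (⊕-cong e ≋-refl) (⊕-swapʳ Γ Δ Θ₂)) ,
  ⊢∷ (⊕-swapʳ Γ Θ₂ (i ↦ [ a ])) ⊢L ⊢P , ⊢N
... | inj₂ q₂
  with _ , P′∈ , ⊢∷ {Γ₁ = Θ₁} p ⊢L ⊢P′ ← find (Anyₚ.map⁻ q₂)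
  with Γ , Δ , a , e , ⊢P , ⊢N ← ⊢ᴮ-linB⁻ i (lose P′∈ ⊢P′) =
  Θ₁ ⊕ Γ , Δ , a , ≋-trans p (≋-trans (⊕-cong ≋-refl e) (≋-sym (⊕-assoc Θ₁ Γ Δ))) ,
  ⊢∷ (⊕-assoc Θ₁ Γ (i ↦ [ a ])) ⊢L ⊢P , ⊢N

⊢-linBag : ∀ i {Γ Δ} Q S {m b} → Γ ⊕ i ↦ m ⊢ₛ S ∶ b → Δ ⊢ᴮ Q ∶ m → Γ ⊕ Δ ⊢ₛ linBag i Q S ∶ b
⊢-linBag i {Γ} [] S ⊢S (⊢[] p) = Any.map (⊢-resp-≋ (⊕-cong ≋-refl (≋-trans (↦-[] i) (≋-sym p)))) ⊢S
⊢-linBag i {Γ} {Δ} (L ∷ Q) S {a ∷ m} ⊢S (⊢∷ {Γ₁ = Δ₁} {Δ₂} p ⊢L ⊢Q) =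
  Any.map (⊢-resp-≋ (≋-trans (⊕-assoc Γ Δ₁ Δ₂) (⊕-cong ≋-refl (≋-sym p))))
    (⊢-linBag i {Γ ⊕ Δ₁} Q (concatMap (linT i L) S)
      (Anyₚ.concatMap⁺ (linT i L) (Any.map (λ ⊢M → Any.map (⊢-resp-≋ (⊕-swapʳ Γ (i ↦ m) Δ₁))
        (⊢-linT i ⊢M Γ⊕i↦a∷m ⊢L)) ⊢S))
      ⊢Q)
  where
  Γ⊕i↦a∷m : Γ ⊕ i ↦ (a ∷ m) ≋ Γ ⊕ i ↦ m ⊕ i ↦ [ a ]
  Γ⊕i↦a∷m = ≋-trans (⊕-cong ≋-refl (≋-trans (↦-++ i [ a ] m) (⊕-comm (i ↦ [ a ]) (i ↦ m))))
                    (≋-sym (⊕-assoc Γ (i ↦ m) (i ↦ [ a ])))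

⊢-linBag⁻ : ∀ i {Θ} Q S {b} → All (λ L → occT i L ≡ false) Q → Θ ⊢ₛ linBag i Q S ∶ b →
  ∃[ Γ ] ∃[ Δ ] ∃[ m ] Θ ≋ Γ ⊕ Δ × Γ ⊕ i ↦ m ⊢ₛ S ∶ b × Δ ⊢ᴮ Q ∶ m
⊢-linBag⁻ i {Θ} [] S _ q =
  Θ , ∅ , [] , ≋-sym (⊕-identityʳ Θ) ,
  Any.map (⊢-resp-≋ (≋-sym (≋-trans (⊕-cong ≋-refl (↦-[] i)) (⊕-identityʳ Θ)))) q , ⊢[] ≋-refl
⊢-linBag⁻ i {Θ} (L ∷ Q) S (i∉L ∷ i∉Q) q
  with Γ′ , Δ₂ , m , Θ≋ , ⊢S′ , ⊢Q ← ⊢-linBag⁻ i Q (concatMap (linT i L) S) i∉Q q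
  with M , M∈ , ⊢linM ← find (Anyₚ.concatMap⁻ (linT i L) ⊢S′)
  with Γ₀ , Δ₁ , a , Γ′⊕≋ , ⊢M , ⊢L ← ⊢-linT⁻ i {Γ′ ⊕ i ↦ m} {M} {L} ⊢linM =
  update i (Γ′ i) Γ₀ , Δ₁ ⊕ Δ₂ , a ∷ m , Θ≋′ , lose M∈ (⊢-resp-≋ Γ₀⊕≋ ⊢M) , ⊢∷ ≋-refl ⊢L ⊢Q
  where
  -- L uses no point at i, so all of Γ′ ⊕ i ↦ m at i goes to Γ₀.
  Δ₁i≋[] : Δ₁ i ↭ []
  Δ₁i≋[] = occ≡false⇒↭[] i i∉L ⊢L
  Γ₀i : Γ′ i ++ m ↭ Γ₀ i
  Γ₀i = ↭-trans (subst (λ u → Γ′ i ++ u ↭ Γ₀ i ++ Δ₁ i) (↦-here i m) (Γ′⊕≋ i))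
          (↭-trans (↭.++⁺ˡ (Γ₀ i) Δ₁i≋[]) (↭.++-identityʳ (Γ₀ i)))
  Θ≋′ : Θ ≋ update i (Γ′ i) Γ₀ ⊕ (Δ₁ ⊕ Δ₂)
  Θ≋′ = ≋-at i
    (subst (λ u → Θ i ↭ u ++ (Δ₁ i ++ Δ₂ i)) (sym (update-here i (Γ′ i) Γ₀))
      (↭-trans (Θ≋ i) (↭.++⁺ˡ (Γ′ i) (↭.++⁺ʳ (Δ₂ i) (↭-sym Δ₁i≋[])))))
    (λ j j≢i → subst (λ u → Θ j ↭ u ++ (Δ₁ j ++ Δ₂ j)) (sym (update-elsewhere i (Γ′ i) Γ₀ j j≢i))
      (↭-trans (Θ≋ j) (↭-trans (↭.++⁺ʳ (Δ₂ j) (⊕↦-elsewhere Γ′⊕≋ j j≢i))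
        (↭-reflexive (List.++-assoc (Γ₀ j) (Δ₁ j) (Δ₂ j))))))
  Γ₀⊕≋ : Γ₀ ⊕ i ↦ [ a ] ≋ update i (Γ′ i) Γ₀ ⊕ i ↦ (a ∷ m)
  Γ₀⊕≋ = ≋-at i
    (subst₂ _↭_ (cong (Γ₀ i ++_) (sym (↦-here i [ a ])))
                (cong₂ _++_ (sym (update-here i (Γ′ i) Γ₀)) (sym (↦-here i (a ∷ m))))
      (↭-trans (↭.++⁺ʳ [ a ] (↭-sym Γ₀i))
        (↭-trans (↭-reflexive (List.++-assoc (Γ′ i) m [ a ]))
          (↭.++⁺ˡ (Γ′ i) (↭-sym (↭.∷↭∷ʳ a m))))))
    (λ j j≢i → subst₂ _↭_ (cong (Γ₀ j ++_) (sym (↦-elsewhere i [ a ] j j≢i)))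
                 (cong₂ _++_ (sym (update-elsewhere i (Γ′ i) Γ₀ j j≢i)) (sym (↦-elsewhere i (a ∷ m) j j≢i)))
                 ↭-refl)

-- Invariance under reduction

⊢-erase0 : ∀ {Γ M b} → Γ ⊢ M ∶ b → Γ 0 ↭ [] → tailᶜ Γ ⊢ₛ erase0 M ∶ b
⊢-erase0 {Γ} {M} {b} ⊢M Γ₀≋[] with occT 0 M in occ₀
... | true  = ⊥-elim (occ≡true⇒≁[] 0 occ₀ ⊢M Γ₀≋[])
... | false = here (⊢-shT⁻ 0 (subst (λ t → Γ ⊢ t ∶ b) (sym (shT∘loT 0 M occ₀)) ⊢M))

⊢-erase0⁻ : ∀ {Γ M b} → Γ ⊢ₛ erase0 M ∶ b → insertᶜ 0 Γ ⊢ M ∶ b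
⊢-erase0⁻ {Γ} {M} {b} q with occT 0 M in occ₀
⊢-erase0⁻ {Γ} {M} {b} () | true
⊢-erase0⁻ {Γ} {M} {b} (here ⊢M) | false = subst (λ t → insertᶜ 0 Γ ⊢ t ∶ b) (shT∘loT 0 M occ₀) (⊢-shT 0 ⊢M)

⊢-β : ∀ {Γ M P b} → Γ ⊢ app (lam M) P ∶ b → Γ ⊢ₛ betaRed M P ∶ b
⊢-β {M = M} {P} (⊢app {Γ₁ = Γ₁} {Γ₂} p (⊢lam {Γ′ = Γ′} {m = m} u q ⊢M) u′ ⊢P)
  with refl , refl ← Unfold-functional u u′ =
  Anyₚ.concatMap⁺ erase0 (Any.map (λ ⊢M′ → Any.map (⊢-resp-≋ (≋-sym p)) (⊢-erase0 ⊢M′ ↭-refl))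
    (⊢-linBag 0 {[] ∷ᶜ Γ₁} {insertᶜ 0 Γ₂} (shB 0 P) (M ∷ []) (here (⊢-resp-≋ Γ′≋ ⊢M)) (⊢ᴮ-shB 0 ⊢P)))
  where
  Γ′≋ : Γ′ ≋ ([] ∷ᶜ Γ₁) ⊕ 0 ↦ m
  Γ′≋ zero    = q zero
  Γ′≋ (suc i) = ↭-trans (q (suc i)) (↭-sym (↭.++-identityʳ (Γ₁ i)))

⊢-β⁻ : ∀ {Γ M P b} → Γ ⊢ₛ betaRed M P ∶ b → Γ ⊢ app (lam M) P ∶ b
⊢-β⁻ {Γ} {M} {P} {b} q
  with Γ′ , Δ , m , Γ≋ , here ⊢M , ⊢P ←
       ⊢-linBag⁻ 0 {insertᶜ 0 Γ} (shB 0 P) (M ∷ []) (occB≡false⇒All 0 _ (occ-shB-self 0 P))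
         (Any.map ⊢-erase0⁻ (Anyₚ.concatMap⁻ erase0 q))
  with Γ′₀≡[] , _ ← ++↭[]⁻ {xs = Γ′ 0} (↭-sym (Γ≋ 0)) =
  ⊢app {Γ₁ = tailᶜ Γ′} {tailᶜ Δ} (Γ≋ ∘ suc) (⊢lam (⊸-unfold m b) Γ′⊕≋ ⊢M) (⊸-unfold m b) (⊢ᴮ-shB⁻ 0 ⊢P)
  where
  Γ′⊕≋ : Γ′ ⊕ 0 ↦ m ≋ m ∷ᶜ tailᶜ Γ′
  Γ′⊕≋ zero rewrite Γ′₀≡[] = ↭-refl
  Γ′⊕≋ (suc i) = ↭.++-identityʳ (Γ′ (suc i))

⊢-termRedex : ∀ {M S Γ b} → TermRedex M S → Γ ⊢ M ∶ b → Γ ⊢ₛ S ∶ b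
⊢-termRedex (β M P) ⊢M = ⊢-β ⊢M
⊢-termRedex (τ̄-nil (τ Ls)) (⊢app {Γ₁ = Γ₁} p ⊢V ∗-unfold (⊢[] q)) =
  here (⊢-resp-≋ (≋-trans (≋-sym (⊕-identityʳ Γ₁)) (≋-trans (⊕-cong ≋-refl (≋-sym q)) (≋-sym p))) ⊢V)
⊢-termRedex (τ̄-cons (τ Ls) L P) (⊢app p (⊢tbar _ _) ∗-unfold ())

⊢-termRedex⁻ : ∀ {M S Γ b} → TermRedex M S → Γ ⊢ₛ S ∶ b → Γ ⊢ M ∶ b
⊢-termRedex⁻ (β M P) q = ⊢-β⁻ q
⊢-termRedex⁻ {Γ = Γ} (τ̄-nil (τ Ls)) (here ⊢V@(⊢tbar _ _)) =
  ⊢app (≋-sym (⊕-identityʳ Γ)) ⊢V ∗-unfold (⊢[] ≋-refl)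
⊢-termRedex⁻ (τ̄-cons V L P) ()

⊢ᴮ-++⁻ : ∀ {Γ} L {R m} → Γ ⊢ᴮ L ++ R ∶ m →
  ∃[ Γ₁ ] ∃[ Γ₂ ] ∃[ m₁ ] ∃[ m₂ ] m ≡ m₁ ++ m₂ × Γ ≋ Γ₁ ⊕ Γ₂ × Γ₁ ⊢ᴮ L ∶ m₁ × Γ₂ ⊢ᴮ R ∶ m₂
⊢ᴮ-++⁻ {Γ} [] ⊢R = ∅ , Γ , [] , _ , refl , ≋-refl , ⊢[] ≋-refl , ⊢R
⊢ᴮ-++⁻ (_ ∷ L) (⊢∷ {Γ₁ = Γₓ} {a = a} p ⊢x ⊢LR)
  with Γ₁ , Γ₂ , m₁ , m₂ , refl , e , ⊢L , ⊢R ← ⊢ᴮ-++⁻ L ⊢LR =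
  Γₓ ⊕ Γ₁ , Γ₂ , a ∷ m₁ , m₂ , refl , ≋-trans p (≋-trans (⊕-cong ≋-refl e) (≋-sym (⊕-assoc Γₓ Γ₁ Γ₂))) ,
  ⊢∷ ≋-refl ⊢x ⊢L , ⊢R

⊢ᴮ-++⁺ : ∀ {Γ₁ Γ₂ L R m₁ m₂} → Γ₁ ⊢ᴮ L ∶ m₁ → Γ₂ ⊢ᴮ R ∶ m₂ → Γ₁ ⊕ Γ₂ ⊢ᴮ L ++ R ∶ m₁ ++ m₂
⊢ᴮ-++⁺ {Γ₂ = Γ₂} (⊢[] p) ⊢R = ⊢ᴮ-resp-≋ (≋-trans (≋-sym (⊕-identityˡ Γ₂)) (⊕-cong (≋-sym p) ≋-refl)) ⊢R
⊢ᴮ-++⁺ {Γ₂ = Γ₂} (⊢∷ {Γ₁ = Γₓ} {Γ₂ = Γ₁} p ⊢x ⊢L) ⊢R =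
  ⊢∷ (≋-trans (⊕-cong p ≋-refl) (⊕-assoc Γₓ Γ₁ Γ₂)) ⊢x (⊢ᴮ-++⁺ ⊢L ⊢R)

⊢-τλ : ∀ {Γ} L M R → Γ ⊢ⱽ τ (L ++ lam M ∷ R) → Γ ⊢ⱽₛ map (λ M′ → τ (L ++ M′ ∷ R)) (erase0 M)
⊢-τλ L M R (m , m≡∗ , ⊢LMR)
  with _ , _ , m₁ , _ , refl , e , ⊢L , ⊢∷ q ⊢λM ⊢R ← ⊢ᴮ-++⁻ L ⊢LMR
  with ∗s₁ , refl ∷ ∗s₃ ← Allₚ.++⁻ m₁ m≡∗
  with ⊢lam ∗-unfold r ⊢M ← ⊢λM =
  Any-mapWith (λ M′ → τ (L ++ M′ ∷ R))
    (λ ⊢M′ → m₁ ++ ∗ ∷ _ , Allₚ.++⁺ ∗s₁ (refl ∷ ∗s₃) ,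
       ⊢ᴮ-resp-≋ (≋-sym e) (⊢ᴮ-++⁺ ⊢L (⊢∷ (≋-trans q (⊕-cong (↭-sym ∘ r ∘ suc) ≋-refl)) ⊢M′ ⊢R)))
    (⊢-erase0 ⊢M (r zero))

⊢-τλ⁻ : ∀ {Γ} L M R → Γ ⊢ⱽₛ map (λ M′ → τ (L ++ M′ ∷ R)) (erase0 M) → Γ ⊢ⱽ τ (L ++ lam M ∷ R)
⊢-τλ⁻ L M R q
  with M′ , M′∈ , (m , m≡∗ , ⊢LM′R) ← find (Anyₚ.map⁻ q)
  with _ , _ , m₁ , _ , refl , e , ⊢L , ⊢∷ {Γ₁ = Γₘ} p ⊢M′ ⊢R ← ⊢ᴮ-++⁻ L ⊢LM′R
  with ∗s₁ , refl ∷ ∗s₃ ← Allₚ.++⁻ m₁ m≡∗ =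
  m₁ ++ ∗ ∷ _ , m≡∗ ,
  ⊢ᴮ-resp-≋ (≋-sym e) (⊢ᴮ-++⁺ ⊢L (⊢∷ p (⊢lam ∗-unfold (λ { zero → ↭-refl ; (suc i) → ↭-refl })
    (⊢-erase0⁻ {Γₘ} (lose M′∈ ⊢M′))) ⊢R))

⊢-ττ̄ : ∀ {Γ} L V R → Γ ⊢ⱽ τ (L ++ tbar (τ V) ∷ R) → Γ ⊢ⱽ τ (L ++ V ++ R)
⊢-ττ̄ L V R (m , m≡∗ , ⊢LVR)
  with _ , _ , m₁ , _ , refl , e , ⊢L , ⊢∷ q (⊢tbar V≡∗ ⊢V) ⊢R ← ⊢ᴮ-++⁻ L ⊢LVR
  with ∗s₁ , refl ∷ ∗s₃ ← Allₚ.++⁻ m₁ m≡∗ =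
  _ , Allₚ.++⁺ ∗s₁ (Allₚ.++⁺ V≡∗ ∗s₃) ,
  ⊢ᴮ-resp-≋ (≋-sym (≋-trans e (⊕-cong ≋-refl q))) (⊢ᴮ-++⁺ ⊢L (⊢ᴮ-++⁺ ⊢V ⊢R))

⊢-ττ̄⁻ : ∀ {Γ} L V R → Γ ⊢ⱽ τ (L ++ V ++ R) → Γ ⊢ⱽ τ (L ++ tbar (τ V) ∷ R)
⊢-ττ̄⁻ L V R (m , m≡∗ , ⊢LVR)
  with _ , _ , m₁ , _ , refl , e , ⊢L , ⊢VR ← ⊢ᴮ-++⁻ L ⊢LVR
  with _ , _ , m₃ , _ , refl , e′ , ⊢V , ⊢R ← ⊢ᴮ-++⁻ V ⊢VR
  with ∗s₁ , ∗s₂ ← Allₚ.++⁻ m₁ m≡∗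
  with ∗s₃ , ∗s₄ ← Allₚ.++⁻ m₃ ∗s₂ =
  _ , Allₚ.++⁺ ∗s₁ (refl ∷ ∗s₄) ,
  ⊢ᴮ-resp-≋ (≋-sym (≋-trans e (⊕-cong ≋-refl e′))) (⊢ᴮ-++⁺ ⊢L (⊢∷ ≋-refl (⊢tbar ∗s₃ ⊢V) ⊢R))

⊢-testRedex : ∀ {V S Γ} → TestRedex V S → Γ ⊢ⱽ V → Γ ⊢ⱽₛ S
⊢-testRedex (τλ L M R) ⊢V = ⊢-τλ L M R ⊢V
⊢-testRedex (ττ̄ L V R) ⊢V = here (⊢-ττ̄ L V R ⊢V)

⊢-testRedex⁻ : ∀ {V S Γ} → TestRedex V S → Γ ⊢ⱽₛ S → Γ ⊢ⱽ V
⊢-testRedex⁻ (τλ L M R) q          = ⊢-τλ⁻ L M R q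
⊢-testRedex⁻ (ττ̄ L V R) (here ⊢V′) = ⊢-ττ̄⁻ L V R ⊢V′

⊢-→T : ∀ {M S Γ b} → M →T S → Γ ⊢ M ∶ b → Γ ⊢ₛ S ∶ b
⊢ᴮ-→B : ∀ {P S Γ m} → P →B S → Γ ⊢ᴮ P ∶ m → Any (Γ ⊢ᴮ_∶ m) S
⊢ⱽ-→V : ∀ {V S Γ} → V →V S → Γ ⊢ⱽ V → Γ ⊢ⱽₛ S
⊢-→T (redex r)     ⊢M = ⊢-termRedex r ⊢M
⊢-→T (lamC st)     (⊢lam u p ⊢M)     = Any-mapWith lam (⊢lam u p) (⊢-→T st ⊢M)
⊢-→T (appL P st)   (⊢app p ⊢M u ⊢P)  = Any-mapWith (λ M′ → app M′ P) (λ ⊢M′ → ⊢app p ⊢M′ u ⊢P) (⊢-→T st ⊢M)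
⊢-→T (appR M st)   (⊢app p ⊢M u ⊢P)  = Any-mapWith (app M) (⊢app p ⊢M u) (⊢ᴮ-→B st ⊢P)
⊢-→T (tbarC st)    (⊢tbar s ⊢P)      = Any-mapWith tbar (⊢tbar⁺ _) (⊢ⱽ-→V st (_ , s , ⊢P))
⊢ᴮ-→B (here P st)  (⊢∷ p ⊢L ⊢P)      = Any-mapWith (_∷ P) (λ ⊢L′ → ⊢∷ p ⊢L′ ⊢P) (⊢-→T st ⊢L)
⊢ᴮ-→B (there L st) (⊢∷ p ⊢L ⊢P)      = Any-mapWith (L ∷_) (⊢∷ p ⊢L) (⊢ᴮ-→B st ⊢P)
⊢ⱽ-→V (redex r)    ⊢V                = ⊢-testRedex r ⊢V
⊢ⱽ-→V (τC st)      (m , s , ⊢P)      = Any-mapWith τ (λ ⊢P′ → m , s , ⊢P′) (⊢ᴮ-→B st ⊢P)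

⊢-→T⁻ : ∀ {M S Γ b} → M →T S → Γ ⊢ₛ S ∶ b → Γ ⊢ M ∶ b
⊢ᴮ-→B⁻ : ∀ {P S Γ m} → P →B S → Any (Γ ⊢ᴮ_∶ m) S → Γ ⊢ᴮ P ∶ m
⊢ⱽ-→V⁻ : ∀ {V S Γ} → V →V S → Γ ⊢ⱽₛ S → Γ ⊢ⱽ V
⊢-→T⁻ (redex r) q = ⊢-termRedex⁻ r q
⊢-→T⁻ (lamC st) q with _ , M′∈ , ⊢lam u p ⊢M′ ← find (Anyₚ.map⁻ q) =
  ⊢lam u p (⊢-→T⁻ st (lose M′∈ ⊢M′))
⊢-→T⁻ (appL P st) q with _ , M′∈ , ⊢app p ⊢M′ u ⊢P ← find (Anyₚ.map⁻ q) =
  ⊢app p (⊢-→T⁻ st (lose M′∈ ⊢M′)) u ⊢P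
⊢-→T⁻ (appR M st) q with _ , P′∈ , ⊢app p ⊢M u ⊢P′ ← find (Anyₚ.map⁻ q) =
  ⊢app p ⊢M u (⊢ᴮ-→B⁻ st (lose P′∈ ⊢P′))
⊢-→T⁻ {tbar V} (tbarC st) q
  with _ , _ , ⊢W ← find (Anyₚ.map⁻ q)
  with refl , _ ← ⊢tbar⁻ ⊢W =
  ⊢tbar⁺ V (⊢ⱽ-→V⁻ st (Any.map (proj₂ ∘ ⊢tbar⁻) (Anyₚ.map⁻ q)))
⊢ᴮ-→B⁻ (here P st) q with _ , L′∈ , ⊢∷ p ⊢L′ ⊢P ← find (Anyₚ.map⁻ q) =
  ⊢∷ p (⊢-→T⁻ st (lose L′∈ ⊢L′)) ⊢P
⊢ᴮ-→B⁻ (there L st) q with _ , P′∈ , ⊢∷ p ⊢L ⊢P′ ← find (Anyₚ.map⁻ q) =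
  ⊢∷ p ⊢L (⊢ᴮ-→B⁻ st (lose P′∈ ⊢P′))
⊢ⱽ-→V⁻ (redex r) q = ⊢-testRedex⁻ r q
⊢ⱽ-→V⁻ (τC st) q with _ , P′∈ , (m , s , ⊢P′) ← find (Anyₚ.map⁻ q) =
  m , s , ⊢ᴮ-→B⁻ st (lose {P = _ ⊢ᴮ_∶ m} P′∈ ⊢P′)

⊢ⱽₛ-SumStep : ∀ {X Y Γ} → SumStep _→V_ X Y → Γ ⊢ⱽₛ X ⇔ Γ ⊢ⱽₛ Y
⊢ⱽₛ-SumStep {Γ = Γ} (sstep L {S = S} R st) = mk⇔ to from
  where
  to : Γ ⊢ⱽₛ L ++ _ ∷ R → Γ ⊢ⱽₛ L ++ S ++ R
  to q with Anyₚ.++⁻ L q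
  ... | inj₁ q₁         = Anyₚ.++⁺ˡ q₁
  ... | inj₂ (here ⊢V)  = Anyₚ.++⁺ʳ L (Anyₚ.++⁺ˡ (⊢ⱽ-→V st ⊢V))
  ... | inj₂ (there q₂) = Anyₚ.++⁺ʳ L (Anyₚ.++⁺ʳ S q₂)
  from : Γ ⊢ⱽₛ L ++ S ++ R → Γ ⊢ⱽₛ L ++ _ ∷ R
  from q with Anyₚ.++⁻ L q
  ... | inj₁ q₁ = Anyₚ.++⁺ˡ q₁
  ... | inj₂ q₂ with Anyₚ.++⁻ S q₂
  ...   | inj₁ q₃ = Anyₚ.++⁺ʳ L (here (⊢ⱽ-→V⁻ st q₃))
  ...   | inj₂ q₄ = Anyₚ.++⁺ʳ L (there q₄)

⊢ⱽₛ-Star : ∀ {X Y Γ} → Star (SumStep _→V_) X Y → Γ ⊢ⱽₛ X ⇔ Γ ⊢ⱽₛ Y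
⊢ⱽₛ-Star done     = ⇔-refl
⊢ⱽₛ-Star (s ◅ ss) = ⇔-trans (⊢ⱽₛ-SumStep s) (⊢ⱽₛ-Star ss)

→spine⇒→T : ∀ {M S} → M →spine S → M →T S
→spine⇒→T (redex r)   = redex r
→spine⇒→T (appL P sp) = appL P (→spine⇒→T sp)

→B-++ˡ : ∀ L {P S} → P →B S → (L ++ P) →B map (L ++_) S
→B-++ˡ []      {S = S} st = subst (_ →B_) (sym (List.map-id S)) st
→B-++ˡ (x ∷ L) {S = S} st = subst (_ →B_) (sym (List.map-∘ S)) (there x (→B-++ˡ L st))

→hV⇒→V : ∀ {V S} → V →hV S → V →V S
→hV⇒→V (redex r)             = redex r
→hV⇒→V (elem L {S = S} R sp) =
  subst (_ →V_) (trans (sym (List.map-∘ (map (_∷ R) S))) (sym (List.map-∘ S)))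
    (τC (→B-++ˡ L (here R (→spine⇒→T sp))))

SumStep-map : ∀ {A : Set} {R R′ : A → List A → Set} → (∀ {a S} → R a S → R′ a S) →
  ∀ {X Y} → SumStep R X Y → SumStep R′ X Y
SumStep-map f (sstep L R st) = sstep L R (f st)

SumStep-++ˡ : ∀ {A : Set} {R : A → List A → Set} Z {X Y} → SumStep R X Y → SumStep R (Z ++ X) (Z ++ Y)
SumStep-++ˡ Z (sstep L {a} {S} R st) =
  subst₂ (SumStep _) (List.++-assoc Z L (a ∷ R)) (List.++-assoc Z L (S ++ R)) (sstep (Z ++ L) R st)

SumStep-++ʳ : ∀ {A : Set} {R : A → List A → Set} Z {X Y} → SumStep R X Y → SumStep R (X ++ Z) (Y ++ Z)
SumStep-++ʳ Z (sstep L {a} {S} R st) =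
  subst₂ (SumStep _) (sym (List.++-assoc L (a ∷ R) Z))
    (trans (cong (L ++_) (sym (List.++-assoc S R Z))) (sym (List.++-assoc L (S ++ R) Z)))
    (sstep L (R ++ Z) st)

-- Head reduction

size : Term → ℕ
sizeᴮ : Bag → ℕ
size (var j)       = 1
size (lam M)       = suc (size M)
size (app M P)     = suc (size M + sizeᴮ P)
size (tbar (τ Ls)) = suc (sizeᴮ Ls)
sizeᴮ []      = 0
sizeᴮ (L ∷ P) = size L + sizeᴮ P

sizeⱽ : Test → ℕ
sizeⱽ (τ Ls) = sizeᴮ Ls

All-mapWith : ∀ {A B : Set} {P : A → Set} {Q : B → Set} (f : A → B) {xs} →
  (∀ {x} → P x → Q (f x)) → All P xs → All Q (map f xs)
All-mapWith f g = Allₚ.map⁺ ∘ All.map g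

All-concatMap⁺ : ∀ {A B : Set} {P : B → Set} (f : A → List B) {xs} →
  All (All P ∘ f) xs → All P (concatMap f xs)
All-concatMap⁺ f = Allₚ.concat⁺ ∘ Allₚ.map⁺

size-shT : ∀ c M → size (shT c M) ≡ size M
sizeᴮ-shB : ∀ c P → sizeᴮ (shB c P) ≡ sizeᴮ P
size-shT c (var j) rewrite shT-var c j = refl
size-shT c (lam M)       = cong suc (size-shT (suc c) M)
size-shT c (app M P)     = cong suc (cong₂ _+_ (size-shT c M) (sizeᴮ-shB c P))
size-shT c (tbar (τ Ls)) = cong suc (sizeᴮ-shB c Ls)
sizeᴮ-shB c []      = refl
sizeᴮ-shB c (L ∷ P) = cong₂ _+_ (size-shT c L) (sizeᴮ-shB c P)

<-+-shiftʳ : ∀ {a b c} d → a < b + c → a + d < b + d + c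
<-+-shiftʳ {a} {b} {c} d a<b+c = subst (a + d <_)
  (trans (ℕ.+-assoc b c d) (trans (cong (b +_) (ℕ.+-comm c d)) (sym (ℕ.+-assoc b d c))))
  (ℕ.+-monoˡ-< d a<b+c)

<-+-shiftˡ : ∀ {a b c} d → a < b + c → d + a < d + b + c
<-+-shiftˡ {a} {b} {c} d a<b+c = subst (d + a <_) (sym (ℕ.+-assoc d b c)) (ℕ.+-monoʳ-< d a<b+c)

-- Linear substitution never duplicates N: this is why head reduction terminates.
size-linT : ∀ i N M → All (λ M′ → size M′ < size M + size N) (linT i N M)
sizeᴮ-linB : ∀ i N P → All (λ P′ → sizeᴮ P′ < sizeᴮ P + size N) (linB i N P)
size-linT i N (var j) with j ≡ᵇ i
... | true  = ℕ.n<1+n _ ∷ []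
... | false = []
size-linT i N (lam M) =
  All-mapWith lam (λ h → s≤s (subst (λ z → _ < size M + z) (size-shT 0 N) h)) (size-linT (suc i) (shT 0 N) M)
size-linT i N (app M P) = Allₚ.++⁺
  (All-mapWith (λ M′ → app M′ P) (s≤s ∘ <-+-shiftʳ {b = size M} {size N} (sizeᴮ P)) (size-linT i N M))
  (All-mapWith (app M) (s≤s ∘ <-+-shiftˡ {b = sizeᴮ P} {size N} (size M)) (sizeᴮ-linB i N P))
size-linT i N (tbar (τ Ls)) = All-mapWith tbar id (All-mapWith τ s≤s (sizeᴮ-linB i N Ls))
sizeᴮ-linB i N []      = []
sizeᴮ-linB i N (L ∷ P) = Allₚ.++⁺
  (All-mapWith (_∷ P) (<-+-shiftʳ {b = size L} {size N} (sizeᴮ P)) (size-linT i N L))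
  (All-mapWith (L ∷_) (<-+-shiftˡ {b = sizeᴮ P} {size N} (size L)) (sizeᴮ-linB i N P))

size-linBag : ∀ i Q S n → All (λ M → size M ≤ n) S → All (λ M′ → size M′ ≤ n + sizeᴮ Q) (linBag i Q S)
size-linBag i []      S n h = All.map (λ {M} → subst (size M ≤_) (sym (ℕ.+-identityʳ n))) h
size-linBag i (L ∷ Q) S n h =
  All.map (λ {M} → subst (size M ≤_) (ℕ.+-assoc n (size L) (sizeᴮ Q)))
    (size-linBag i Q (concatMap (linT i L) S) (n + size L)
      (All-concatMap⁺ (linT i L)
        (All.map (λ {M} M≤n → All.map (λ lt → ℕ.<⇒≤ (ℕ.<-≤-trans lt (ℕ.+-monoˡ-≤ (size L) M≤n)))
                                       (size-linT i L M)) h)))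

size-erase0 : ∀ M → All (λ M′ → size M′ ≡ size M) (erase0 M)
size-erase0 M with occT 0 M in 0∉M
... | true  = []
... | false = trans (sym (size-shT 0 (loT 0 M))) (cong size (shT∘loT 0 M 0∉M)) ∷ []

size-betaRed : ∀ M P → All (λ M′ → size M′ ≤ size M + sizeᴮ P) (betaRed M P)
size-betaRed M P = All-concatMap⁺ erase0
  (All.map (λ {M′} M′≤ → All.map (λ e → subst (_≤ _) (sym e) M′≤) (size-erase0 M′))
    (subst (λ z → All (λ M′ → size M′ ≤ size M + z) (linBag 0 (shB 0 P) (M ∷ []))) (sizeᴮ-shB 0 P)
      (size-linBag 0 (shB 0 P) (M ∷ []) (size M) (ℕ.≤-refl ∷ []))))

size-→spine : ∀ {M S} → M →spine S → All (λ M′ → size M′ < size M) S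
size-→spine (redex (β M P))          = All.map (λ le → s≤s (ℕ.≤-trans le (ℕ.n≤1+n _))) (size-betaRed M P)
size-→spine (redex (τ̄-nil (τ Ls)))   = s≤s (ℕ.≤-reflexive (sym (ℕ.+-identityʳ _))) ∷ []
size-→spine (redex (τ̄-cons V L P))   = []
size-→spine (appL P sp) = All-mapWith (λ M′ → app M′ P) (s≤s ∘ ℕ.+-monoˡ-< (sizeᴮ P)) (size-→spine sp)

sizeᴮ-++ : ∀ L R → sizeᴮ (L ++ R) ≡ sizeᴮ L + sizeᴮ R
sizeᴮ-++ []      R = refl
sizeᴮ-++ (x ∷ L) R = trans (cong (size x +_) (sizeᴮ-++ L R)) (sym (ℕ.+-assoc (size x) (sizeᴮ L) (sizeᴮ R)))

sizeᴮ-mid-< : ∀ L R {X Y} → sizeᴮ X < sizeᴮ Y → sizeᴮ (L ++ X ++ R) < sizeᴮ (L ++ Y ++ R)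
sizeᴮ-mid-< L R {X} {Y} X<Y rewrite sizeᴮ-++ L (X ++ R) | sizeᴮ-++ L (Y ++ R) | sizeᴮ-++ X R | sizeᴮ-++ Y R =
  ℕ.+-monoʳ-< (sizeᴮ L) (ℕ.+-monoˡ-< (sizeᴮ R) X<Y)

sizeᴮ-elem-< : ∀ L R {X Y} → size X < size Y → sizeᴮ (L ++ X ∷ R) < sizeᴮ (L ++ Y ∷ R)
sizeᴮ-elem-< L R {X} {Y} X<Y =
  sizeᴮ-mid-< L R {[ X ]} {[ Y ]} (subst₂ _<_ (sym (ℕ.+-identityʳ _)) (sym (ℕ.+-identityʳ _)) X<Y)

sizeⱽ-→hV : ∀ {V S} → V →hV S → All (λ W → sizeⱽ W < sizeⱽ V) S
sizeⱽ-→hV (redex (τλ L M R)) = All-mapWith (λ M′ → τ (L ++ M′ ∷ R))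
  (λ e → sizeᴮ-elem-< L R (subst (_< suc (size M)) (sym e) (ℕ.n<1+n _))) (size-erase0 M)
sizeⱽ-→hV (redex (ττ̄ L V R)) =
  sizeᴮ-mid-< L R {V} {[ tbar (τ V) ]} (subst (sizeᴮ V <_) (sym (ℕ.+-identityʳ _)) (ℕ.n<1+n _)) ∷ []
sizeⱽ-→hV (elem L R sp) = All-mapWith (λ M′ → τ (L ++ M′ ∷ R)) (sizeᴮ-elem-< L R) (size-→spine sp)

Closed : Term → Set
Closed M = ∀ i → occT i M ≡ false

Closed₁ : Term → Set
Closed₁ M = ∀ i → occT (suc i) M ≡ false

Closedᴮ : Bag → Set
Closedᴮ P = ∀ i → occB i P ≡ false

All-swap : ∀ {A : Set} {P : ℕ → A → Set} {xs} → (∀ i → All (P i) xs) → All (λ x → ∀ i → P i x) xs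
All-swap {xs = []}    f = []
All-swap {xs = x ∷ xs} f = (All.head ∘ f) ∷ All-swap (All.tail ∘ f)

occ-linT : ∀ i N M j → occT j M ≡ false → occT j N ≡ false → All (λ M′ → occT j M′ ≡ false) (linT i N M)
occ-linB : ∀ i N P j → occB j P ≡ false → occT j N ≡ false → All (λ P′ → occB j P′ ≡ false) (linB i N P)
occ-linT i N (var k) j j∉M j∉N with k ≡ᵇ i
... | true  = j∉N ∷ []
... | false = []
occ-linT i N (lam M) j j∉M j∉N =
  All-mapWith lam id (occ-linT (suc i) (shT 0 N) M (suc j) j∉M (trans (occ-shT 0 j N) j∉N))
occ-linT i N (app M P) j j∉MP j∉N with j∉M , j∉P ← ∨-false⁻ {occT j M} j∉MP = Allₚ.++⁺
  (All-mapWith (λ M′ → app M′ P) (λ j∉M′ → ∨-false⁺ j∉M′ j∉P) (occ-linT i N M j j∉M j∉N))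
  (All-mapWith (app M) (∨-false⁺ j∉M) (occ-linB i N P j j∉P j∉N))
occ-linT i N (tbar (τ Ls)) j j∉M j∉N = All-mapWith tbar id (All-mapWith τ id (occ-linB i N Ls j j∉M j∉N))
occ-linB i N []      j _ _ = []
occ-linB i N (L ∷ P) j j∉LP j∉N with j∉L , j∉P ← ∨-false⁻ {occT j L} j∉LP = Allₚ.++⁺
  (All-mapWith (_∷ P) (λ j∉L′ → ∨-false⁺ j∉L′ j∉P) (occ-linT i N L j j∉L j∉N))
  (All-mapWith (L ∷_) (∨-false⁺ j∉L) (occ-linB i N P j j∉P j∉N))

Closed₁-linBag : ∀ i Q S → All Closed₁ S → All Closed₁ Q → All Closed₁ (linBag i Q S)
Closed₁-linBag i []      S clS _ = clS
Closed₁-linBag i (L ∷ Q) S clS (clL ∷ clQ) =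
  Closed₁-linBag i Q (concatMap (linT i L) S)
    (All-concatMap⁺ (linT i L) (All.map (λ {M} clM → All-swap (λ j → occ-linT i L M (suc j) (clM j) (clL j))) clS))
    clQ

Closed-erase0 : ∀ M → Closed₁ M → All Closed (erase0 M)
Closed-erase0 M clM with occT 0 M in 0∉M
... | true  = []
... | false = (λ j → trans (occ-loT j) (clM j)) ∷ []
  where
  occ-loT : ∀ j → occT j (loT 0 M) ≡ occT (suc j) M
  occ-loT j = trans (sym (occ-shT 0 j (loT 0 M))) (cong (occT (suc j)) (shT∘loT 0 M 0∉M))

Closed-betaRed : ∀ M P → Closed₁ M → Closedᴮ P → All Closed (betaRed M P)
Closed-betaRed M P clM clP = All-concatMap⁺ erase0 (All.map (λ {M′} → Closed-erase0 M′)
  (Closed₁-linBag 0 (shB 0 P) (M ∷ []) (clM ∷ [])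
    (All-swap (λ j → occB≡false⇒All (suc j) (shB 0 P) (trans (occ-shB 0 j P) (clP j))))))

Closed-→spine : ∀ {M S} → M →spine S → Closed M → All Closed S
Closed-→spine (redex (β M P)) cl =
  Closed-betaRed M P (proj₁ ∘ ∨-false⁻ ∘ cl) (λ j → proj₂ (∨-false⁻ {occT (suc j) M} (cl j)))
Closed-→spine (redex (τ̄-nil V))      cl = (proj₁ ∘ ∨-false⁻ ∘ cl) ∷ []
Closed-→spine (redex (τ̄-cons V L P)) cl = []
Closed-→spine (appL {M} P sp)        cl = All-mapWith (λ M′ → app M′ P)
  (λ clM′ j → ∨-false⁺ (clM′ j) (proj₂ (∨-false⁻ {occT j M} (cl j))))
  (Closed-→spine sp (proj₁ ∘ ∨-false⁻ ∘ cl))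

occB-++ : ∀ i L R → occB i (L ++ R) ≡ occB i L ∨ occB i R
occB-++ i []      R = refl
occB-++ i (x ∷ L) R = trans (cong (occT i x ∨_) (occB-++ i L R)) (sym (Bool.∨-assoc (occT i x) (occB i L) (occB i R)))

Closedᴮ-++⁻ : ∀ L R → Closedᴮ (L ++ R) → Closedᴮ L × Closedᴮ R
Closedᴮ-++⁻ L R cl = (λ i → proj₁ (∨-false⁻ (trans (sym (occB-++ i L R)) (cl i)))) ,
                     (λ i → proj₂ (∨-false⁻ {occB i L} (trans (sym (occB-++ i L R)) (cl i))))

Closedᴮ-++⁺ : ∀ L R → Closedᴮ L → Closedᴮ R → Closedᴮ (L ++ R)
Closedᴮ-++⁺ L R clL clR i = trans (occB-++ i L R) (∨-false⁺ (clL i) (clR i))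

Closedᴮ-mid⁻ : ∀ L R {X} → Closedᴮ (L ++ X ∷ R) → Closedᴮ L × Closed X × Closedᴮ R
Closedᴮ-mid⁻ L R {X} cl with clL , clXR ← Closedᴮ-++⁻ L (X ∷ R) cl =
  clL , (λ i → proj₁ (∨-false⁻ (clXR i))) , (λ i → proj₂ (∨-false⁻ {occT i X} (clXR i)))

Closedᴮ-mid⁺ : ∀ L R {X} → Closedᴮ L → Closed X → Closedᴮ R → Closedᴮ (L ++ X ∷ R)
Closedᴮ-mid⁺ L R {X} clL clX clR = Closedᴮ-++⁺ L (X ∷ R) clL (λ i → ∨-false⁺ (clX i) (clR i))

ClosedTest-→hV : ∀ {V S} → V →hV S → ClosedTest V → All ClosedTest S
ClosedTest-→hV (redex (τλ L M R)) cl with clL , clλM , clR ← Closedᴮ-mid⁻ L R cl =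
  All-mapWith (λ M′ → τ (L ++ M′ ∷ R)) (λ clM′ → Closedᴮ-mid⁺ L R clL clM′ clR) (Closed-erase0 M clλM)
ClosedTest-→hV (redex (ττ̄ L V R)) cl with clL , clV , clR ← Closedᴮ-mid⁻ L R cl =
  Closedᴮ-++⁺ L (V ++ R) clL (Closedᴮ-++⁺ V R clV clR) ∷ []
ClosedTest-→hV (elem L R sp) cl with clL , clM , clR ← Closedᴮ-mid⁻ L R cl =
  All-mapWith (λ M′ → τ (L ++ M′ ∷ R)) (λ clM′ → Closedᴮ-mid⁺ L R clL clM′ clR) (Closed-→spine sp clM)

→spine-progress : ∀ M P → (∃ λ S → app M P →spine S) ⊎ (∃ λ j → occT j (app M P) ≡ true)
→spine-progress (var j)    P       = inj₂ (j , cong (_∨ occB j P) (≡ᵇ-refl j))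
→spine-progress (lam M)    P       = inj₁ (_ , redex (β M P))
→spine-progress (tbar V)   []      = inj₁ (_ , redex (τ̄-nil V))
→spine-progress (tbar V)   (L ∷ P) = inj₁ (_ , redex (τ̄-cons V L P))
→spine-progress (app M P′) P with →spine-progress M P′
... | inj₁ (S , sp) = inj₁ (_ , appL P sp)
... | inj₂ (j , e)  = inj₂ (j , cong (_∨ occB j P) e)

→hV-progress : ∀ V → ClosedTest V → V ≡ ε ⊎ ∃ (V →hV_)
→hV-progress (τ [])                    cl = inj₁ refl
→hV-progress (τ (lam M ∷ R))           cl = inj₂ (_ , redex (τλ [] M R))
→hV-progress (τ (tbar (τ Ls) ∷ R))     cl = inj₂ (_ , redex (ττ̄ [] Ls R))
→hV-progress (τ (var j ∷ R))           cl
  with () ← trans (sym (cl j)) (cong (_∨ occB j R) (≡ᵇ-refl j))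
→hV-progress (τ (app M P ∷ R))         cl with →spine-progress M P
... | inj₁ (S , sp) = inj₂ (_ , elem [] R sp)
... | inj₂ (j , e) with () ← trans (sym (cl j)) (cong (_∨ occB j R) e)

HeadNormalises : List Test → Set
HeadNormalises X = ∃ λ H → Star (SumStep _→hV_) X H × All (_≡ ε) H

headNormalises : ∀ n V → sizeⱽ V < n → ClosedTest V → HeadNormalises [ V ]
headNormalisesₛ : ∀ n S → All (λ W → sizeⱽ W < n) S → All ClosedTest S → HeadNormalises S
headNormalises (suc n) V V<n cl with →hV-progress V cl
... | inj₁ refl     = [ ε ] , done , refl ∷ []
... | inj₂ (S , st)
  with H , S↠H , H≡ε ← headNormalisesₛ n S (All.map (λ W<V → ℕ.<-≤-trans W<V (ℕ.≤-pred V<n)) (sizeⱽ-→hV st))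
                                           (ClosedTest-→hV st cl) =
  H , subst (SumStep _→hV_ [ V ]) (List.++-identityʳ S) (sstep [] [] st) ◅ S↠H , H≡ε
headNormalisesₛ n []      _           _           = [] , done , []
headNormalisesₛ n (W ∷ S) (W<n ∷ S<n) (clW ∷ clS)
  with H₁ , W↠H₁ , H₁≡ε ← headNormalises n W W<n clW
  with H₂ , S↠H₂ , H₂≡ε ← headNormalisesₛ n S S<n clS =
  H₁ ++ H₂ , Star.gmap (_++ S) (SumStep-++ʳ S) W↠H₁ ◅◅ Star.gmap (H₁ ++_) (SumStep-++ˡ H₁) S↠H₂ ,
  Allₚ.++⁺ H₁≡ε H₂≡ε

headNormalise : ∀ {V} → ClosedTest V → HeadNormalises [ V ]
headNormalise {V} = headNormalises (suc (sizeⱽ V)) V (ℕ.n<1+n _)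

-- The semantics of a closed test decides its normal form

≈Σ-sym : ∀ {S S′} → S ≈Σ S′ → S′ ≈Σ S
≈Σ-sym S≈S′ W = mk⇔ (Equivalence.from (S≈S′ W)) (Equivalence.to (S≈S′ W))

Any-resp-≈Σ : ∀ {P : Test → Set} {S S′} → S ≈Σ S′ → Any P S → Any P S′
Any-resp-≈Σ S≈S′ q with W , W∈S , PW ← find q = lose (Equivalence.to (S≈S′ W) W∈S) PW

εs≈Σε : ∀ {W H} → All (_≡ ε) (W ∷ H) → (W ∷ H) ≈Σ [ ε ]
εs≈Σε (refl ∷ H≡ε) W′ = mk⇔ (λ W′∈ → here (All.lookup (refl ∷ H≡ε) W′∈)) (λ { (here refl) → here refl })

Star-→hV⇒→V : ∀ {X Y} → Star (SumStep _→hV_) X Y → Star (SumStep _→V_) X Y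
Star-→hV⇒→V = Star.map (SumStep-map →hV⇒→V)

↠ₕ⇒↠ : ∀ {V S} → V ↠ₕ S → V ↠ S
↠ₕ⇒↠ (X , V↠ₕX , X≈S) = X , Star-→hV⇒→V V↠ₕX , X≈S

↠ε⇒⊢ⱽ : ∀ {V} → V ↠ [ ε ] → ∅ ⊢ⱽ V
↠ε⇒⊢ⱽ (X , V↠X , X≈ε) with here ⊢V ← Equivalence.from (⊢ⱽₛ-Star V↠X) (Any-resp-≈Σ (≈Σ-sym X≈ε) (here ⊢ε)) = ⊢V

↠0⇒¬⊢ⱽ : ∀ {V} → V ↠ [] → ¬ (∅ ⊢ⱽ V)
↠0⇒¬⊢ⱽ (X , V↠X , X≈0) ⊢V with () ← Any-resp-≈Σ X≈0 (Equivalence.to (⊢ⱽₛ-Star V↠X) (here ⊢V))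

⊢ⱽ⇒↠ₕε : ∀ {V} → ClosedTest V → ∅ ⊢ⱽ V → V ↠ₕ [ ε ]
⊢ⱽ⇒↠ₕε cl ⊢V with H , V↠H , H≡ε ← headNormalise cl
  -- a summand of H is denoted in ∅, so H is not the empty sum
  with Equivalence.to (⊢ⱽₛ-Star (Star-→hV⇒→V V↠H)) (here ⊢V)
... | here  _ = H , V↠H , εs≈Σε H≡ε
... | there _ = H , V↠H , εs≈Σε H≡ε

¬⊢ⱽ⇒↠ₕ0 : ∀ {V} → ClosedTest V → ¬ (∅ ⊢ⱽ V) → V ↠ₕ []
¬⊢ⱽ⇒↠ₕ0 cl ¬⊢V with headNormalise cl
... | []    , V↠H , _        = [] , V↠H , λ _ → ⇔-refl
... | _ ∷ _ , V↠H , refl ∷ _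
  with here ⊢V ← Equivalence.from (⊢ⱽₛ-Star (Star-→hV⇒→V V↠H)) (here ⊢ε) = ⊥-elim (¬⊢V ⊢V)

lemma7p19 : (V : Test) → ClosedTest V →
    ((V ↠ (ε ∷ [])) ⇔ (V ↠ₕ (ε ∷ []))) × ((V ↠ []) ⇔ (V ↠ₕ []))
lemma7p19 V cl = mk⇔ (⊢ⱽ⇒↠ₕε cl ∘ ↠ε⇒⊢ⱽ) ↠ₕ⇒↠ , mk⇔ (¬⊢ⱽ⇒↠ₕ0 cl ∘ ↠0⇒¬⊢ⱽ) ↠ₕ⇒↠
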